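{- Let $m\ge1$, $\gamma\in\{0,1\}^{m-1}$, and let $a_1,\dots,a_m,b_1,\dots,b_{m-1}$ be indeterminates (with no relations imposed). Then $$\Sigma(\gamma)=\Sigma_{pi}(\gamma)=\det M(\gamma).$$
   Context: A partition $\lambda$ is compatible with $\gamma=(\gamma_1,\dots,\gamma_{m-1})$ if every part of $\lambda$ is at most $m$ and $\lambda_{j+1}>\#\{k\le j:\gamma_k=1\}$ for all $j=1,\dots,\ell(\lambda)-1$. An index $j$ is critical in $\lambda$ if $2\le j\le\ell(\lambda)$ and $\lambda_j=\lambda_{j-1}$; the weight of $\lambda$ is $w(\lambda)=\prod_{j\ \mathrm{critical}}(a_{\lambda_j}+b_{j-1})$. $P_{j,i}(\gamma)$ is the sum of $w(\lambda)$ over partitions $\lambda$ of length $i$ with first part $j$ compatible with $\gamma$, and $M(\gamma)$ is the $m\times m$ matrix with $(j,i)$ entry $P_{j,i}(\gamma)$. A triangular tableau compatible with $\gamma$ is a sequence $R=(\lambda^{(1)},\dots,\lambda^{(m)})$ of partitions compatible with $\gamma$, $\lambda^{(i)}$ of length $i$, such that $\sigma_R=[\lambda^{(1)}_1,\dots,\lambda^{(m)}_1]$ is a permutation of $S_m$; its weight is $w(R)=\mathrm{sgn}(\sigma_R)\prod_{i=1}^m w(\lambda^{(i)})$. It is non-intersecting if for each $j=1,\dots,m$ the $j$-th parts of $\lambda^{(j)},\dots,\lambda^{(m)}$ are pairwise distinct. $\Sigma_{pi}(\gamma)$ is the sum of $w(R)$ over all triangular tableaux compatible with $\gamma$, and $\Sigma(\gamma)$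 is the sum of $w(R)$ over the non-intersecting ones. -}

module Defs where

open import Level using (Level)
open import Data.Bool using (Bool; true; false; _∧_; if_then_else_; not)
open import Data.Nat using (ℕ; zero; suc; _<ᵇ_; _≡ᵇ_) renaming (_∸_ to _-ℕ_; _+_ to _+ℕ_)
open import Data.List using (List; []; _∷_; [_]; map; concatMap; filter; foldr; length; take; drop; upTo; _++_; head; applyUpTo)
open import Data.Bool.ListAction using (and; or)
open import Data.Vec using (Vec; toList)
open import Data.Bool.Properties using (T?)
open import Algebra.Bundles using (CommutativeRing)

-- Conventions (all 1-based, as in the paper):
--  * a partition λ = (λ₁ ≥ … ≥ λ_ℓ), λ_ℓ ≥ 1, is a List ℕ [λ₁, …, λ_ℓ];
--  * γ = (γ₁,…,γ_{m-1}) ∈ {0,1}^{m-1} is a Vec Bool (m-1), true = 1;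
--  * m = suc n (so m ≥ 1), γ : Vec Bool n.

range : ℕ → List ℕ
range m = applyUpTo suc m

allLists : ℕ → ℕ → List (List ℕ)
allLists zero    m = [ [] ]
allLists (suc i) m = concatMap (λ x → map (x ∷_) (allLists i m)) (range m)

weaklyDecreasing : List ℕ → Bool
weaklyDecreasing (x ∷ y ∷ r) = not (x <ᵇ y) ∧ weaklyDecreasing (y ∷ r)
weaklyDecreasing _ = true

ones : List Bool → ℕ → ℕ
ones γ j = length (filter (λ g → T? g) (take j γ))

-- λ_{j+1} > #{k ≤ j : γ_k = 1} for all j = 1,…,ℓ(λ)-1
-- (compatGo γ j rest checks this for rest = [λ_{j+1}, λ_{j+2}, …])
compatGo : List Bool → ℕ → List ℕ → Bool
compatGo γ j []      = true
compatGo γ j (y ∷ r) = (ones γ j <ᵇ y) ∧ compatGo γ (suc j) r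

-- λ (whose parts already lie in {1,…,m}) is a partition compatible with γ
isCompatiblePartition : List Bool → List ℕ → Bool
isCompatiblePartition γ λ′ = weaklyDecreasing λ′ ∧ compatGo γ 1 (drop 1 λ′)

-- all partitions of length i with all parts ≤ m compatible with γ
-- (m = suc n, γ of length n = m - 1)
compatParts : (n : ℕ) → Vec Bool n → ℕ → List (List ℕ)
compatParts n γ i = filter (λ λ′ → T? (isCompatiblePartition (toList γ) λ′)) (allLists i (suc n))

firstPart : List ℕ → ℕ
firstPart []      = 0
firstPart (x ∷ _) = x

-- j-th part (1-based); 0 if out of range (never used out of range)
part : ℕ → List ℕ → ℕ
part j λ′ = firstPart (drop (j -ℕ 1) λ′)

isPerm : ℕ → List ℕ → Bool
isPerm m σ = (length σ ≡ᵇ m) ∧ and (map (λ k → or (map (λ x → x ≡ᵇ k) σ)) (range m))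

distinct : List ℕ → Bool
distinct []      = true
distinct (x ∷ r) = not (or (map (λ y → x ≡ᵇ y) r)) ∧ distinct r

inversions : List ℕ → ℕ
inversions []      = 0
inversions (x ∷ r) = length (filter (λ y → T? (y <ᵇ x)) r) +ℕ inversions r

isEven : ℕ → Bool
isEven zero          = true
isEven (suc zero)    = false
isEven (suc (suc k)) = isEven k

-- all permutations of S_m, in one-line notation [σ(1),…,σ(m)]
perms : ℕ → List (List ℕ)
perms m = filter (λ σ → T? (isPerm m σ)) (allLists m m)

seqs : (n : ℕ) → Vec Bool n → ℕ → List (List (List ℕ))
seqs n γ zero    = [ [] ]
seqs n γ (suc k) = concatMap (λ R → map (λ l → R ++ [ l ]) (compatParts n γ (suc k))) (seqs n γ k)

tableaux : (n : ℕ) → Vec Bool n → List (List (List ℕ))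
tableaux n γ = filter (λ R → T? (isPerm (suc n) (map firstPart R))) (seqs n γ (suc n))

nonIntersecting : ℕ → List (List ℕ) → Bool
nonIntersecting m R = and (map (λ j → distinct (map (part j) (drop (j -ℕ 1) R))) (range m))

module WithRing {c ℓ : Level} (ℛ : CommutativeRing c ℓ) where
  open CommutativeRing ℛ

  sumR : List Carrier → Carrier
  sumR = foldr _+_ 0#

  prodR : List Carrier → Carrier
  prodR = foldr _*_ 1#

  sgn : List ℕ → Carrier
  sgn σ = if isEven (inversions σ) then 1# else - 1#

  -- Weight of λ: product over critical j (2 ≤ j ≤ ℓ, λ_j = λ_{j-1}) of a_{λ_j} + b_{j-1}.
  -- weightGo a b j (λ_j ∷ λ_{j+1} ∷ …)
  weightGo : (ℕ → Carrier) → (ℕ → Carrier) → ℕ → List ℕ → Carrier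
  weightGo a b j (x ∷ y ∷ r) =
    (if x ≡ᵇ y then a y + b j else 1#) * weightGo a b (suc j) (y ∷ r)
  weightGo a b j _ = 1#

  weight : (ℕ → Carrier) → (ℕ → Carrier) → List ℕ → Carrier
  weight a b λ′ = weightGo a b 1 λ′

  P : (n : ℕ) → Vec Bool n → (ℕ → Carrier) → (ℕ → Carrier) → ℕ → ℕ → Carrier
  P n γ a b j i =
    sumR (map (weight a b) (filter (λ λ′ → T? (firstPart λ′ ≡ᵇ j)) (compatParts n γ i)))

  det : ℕ → (ℕ → ℕ → Carrier) → Carrier
  det m A = sumR (map (λ σ → sgn σ * prodR (map (λ i → A i (part i σ)) (range m))) (perms m))

  M : (n : ℕ) → Vec Bool n → (ℕ → Carrier) → (ℕ → Carrier) → ℕ → ℕ → Carrier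
  M n γ a b j i = P n γ a b j i

  tabWeight : (ℕ → Carrier) → (ℕ → Carrier) → List (List ℕ) → Carrier
  tabWeight a b R = sgn (map firstPart R) * prodR (map (weight a b) R)

  Σpi : (n : ℕ) → Vec Bool n → (ℕ → Carrier) → (ℕ → Carrier) → Carrier
  Σpi n γ a b = sumR (map (tabWeight a b) (tableaux n γ))

  Σni : (n : ℕ) → Vec Bool n → (ℕ → Carrier) → (ℕ → Carrier) → Carrier
  Σni n γ a b =
    sumR (map (tabWeight a b) (filter (λ R → T? (nonIntersecting (suc n) R)) (tableaux n γ)))

module Submission where

-- Expanding det M(γ) = Σ_σ sgn σ ∏_i P_{i,σ(i)} by distributivity gives a
-- signed sum over "transposed" families μ whose row i has first part i and length σ(i).
-- Re-listing μ by length is a bijection onto the triangular tableaux; it keeps the product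
-- of the weights, and the permutation of first parts it produces has as many inversions
-- as σ, since both numbers count the pairs of rows ordered oppositely by the two keys.
--
-- On the tableaux that are not non-intersecting an exchange ι acts: in the
-- first column with a repeated entry c, the first two rows meeting at c exchange their
-- parts before c.  ι is an involution without fixed points which keeps compatibility and
-- the product of the weights but transposes two first parts, so these terms cancel.

open import Defs
open import Level using (Level; _⊔_)
open import Function using (_∘_; mk⇔; Equivalence)
open import Data.Empty using (⊥-elim)
open import Data.Unit using (tt)
open import Data.Bool using (Bool; true; false; _∧_; _∨_; not; T; if_then_else_)
open import Data.Bool.Properties using (T?; T-∧; T-≡; not-involutive; ∧-comm; ∨-comm; ∧-assoc; ∧-identityʳ)
open import Data.Bool.ListAction using (or; all)
open import Data.Nat using (ℕ; zero; suc; _+_; _∸_; _≤_; _<_; z≤n; s≤s; _≡ᵇ_; _<ᵇ_)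
import Data.Nat.Properties as ℕₚ
open import Algebra.Properties.CommutativeSemigroup ℕₚ.+-commutativeSemigroup using (x∙yz≈y∙xz)
open ℕₚ using (≡ᵇ⇒≡; ≡⇒≡ᵇ; <ᵇ⇒<; <⇒<ᵇ; suc-injective; <-irrefl; <-cmp; ≤-refl; ≤-trans; <⇒≤)
open import Data.Product using (∃; ∃₂; _×_; _,_; proj₁; proj₂; map₁)
open import Data.Maybe as Maybe using (Maybe; just; nothing)
open import Data.Vec using (Vec; toList)
open import Data.List using (List; []; _∷_; [_]; _++_; map; concatMap; filter; length; take; drop; applyUpTo; replicate; findᵇ)
import Data.List.Properties as List
open import Data.List.Membership.Propositional using (_∈_; find)
open import Data.List.Membership.Propositional.Properties
  using (∈-∃++; ∈-map⁺; ∈-map⁻; ∈-filter⁺; ∈-filter⁻; ∈-concatMap⁺; ∈-concatMap⁻; ∈-applyUpTo⁻)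
open import Data.List.Membership.Propositional.Properties.WithK using (unique∧set⇒bag)
open import Data.List.Relation.Unary.Any using (here; there)
import Data.List.Relation.Unary.Any as Any
open import Data.List.Relation.Unary.Any.Properties using (any⁺; any⁻)
open import Data.List.Relation.Unary.All using (All; []; _∷_)
import Data.List.Relation.Unary.All as All
import Data.List.Relation.Unary.All.Properties as All
open import Data.List.Relation.Unary.AllPairs as AllPairs using (AllPairs; []; _∷_)
import Data.List.Relation.Unary.AllPairs.Properties as AllPairsₚ
open import Data.List.Relation.Unary.Unique.Propositional using (Unique)
import Data.List.Relation.Unary.Unique.Propositional.Properties as Unique
open import Data.List.Relation.Binary.Pointwise using (Pointwise; []; _∷_)
open import Data.List.Relation.Binary.Permutation.Propositional
  using (_↭_; ↭-refl; ↭-reflexive; ↭-sym; ↭-trans; ↭-prep; ↭-swap; ↭⇒↭ₛ; ↭⇒↭ₛ′)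
import Data.List.Relation.Binary.Permutation.Propositional as ↭
open ↭ using (module PermutationReasoning)
open import Data.List.Relation.Binary.Permutation.Propositional.Properties
  using (∈-resp-↭; shift; ↭-length; map⁺; filter-↭; ++⁺ˡ)
import Data.List.Relation.Binary.Permutation.Setoid.Properties as SetoidPerm
open import Data.List.Relation.Binary.BagAndSetEquality using (∼bag⇒↭)
open import Relation.Nullary using (¬_; yes; no; ¬?)
open import Relation.Binary.Definitions using (tri<; tri≈; tri>)
open import Relation.Unary using (Pred; Decidable)
open import Relation.Binary.PropositionalEquality
  using (_≡_; _≢_; refl; sym; trans; cong; cong₂; subst; module ≡-Reasoning)
import Relation.Binary.PropositionalEquality as ≡
open import Algebra.Bundles using (CommutativeRing)

private variable
  ℓ₁ ℓ₂ : Level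
  A : Set ℓ₁
  B : Set ℓ₂

T-not⁻ : ∀ {b} → T (not b) → ¬ T b
T-not⁻ {false} _ ()

T-not⁺ : ∀ {b} → ¬ T b → T (not b)
T-not⁺ {false} _   = tt
T-not⁺ {true}  ¬tt = ¬tt tt

T-ext : ∀ {x y : Bool} → (T x → T y) → (T y → T x) → x ≡ y
T-ext {true}  {true}  _ _ = refl
T-ext {true}  {false} f _ = ⊥-elim (f tt)
T-ext {false} {true}  _ g = ⊥-elim (g tt)
T-ext {false} {false} _ _ = refl

<ᵇ-true : ∀ {m n} → m < n → (m <ᵇ n) ≡ true
<ᵇ-true m<n = Equivalence.to T-≡ (<⇒<ᵇ m<n)

<ᵇ-false : ∀ {m n} → n ≤ m → (m <ᵇ n) ≡ false
<ᵇ-false {m} {n} n≤m with m <ᵇ n in eq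
... | false = refl
... | true  = ⊥-elim (<-irrefl refl (≤-trans (<ᵇ⇒< m n (Equivalence.from T-≡ eq)) n≤m))

∈⇒↭ : ∀ {x : A} {xs} → x ∈ xs → ∃ λ ys → xs ↭ x ∷ ys
∈⇒↭ x∈xs with ∈-∃++ x∈xs
... | ys , zs , refl = ys ++ zs , shift _ ys zs

Unique-resp-↭ : {xs ys : List A} → xs ↭ ys → Unique xs → Unique ys
Unique-resp-↭ {A = A} p = SetoidPerm.Unique-resp-↭ (≡.setoid A) (↭⇒↭ₛ p)

unique-↭ : {xs ys : List A} → Unique xs → Unique ys →
           (∀ {z} → z ∈ xs → z ∈ ys) → (∀ {z} → z ∈ ys → z ∈ xs) → xs ↭ ys
unique-↭ ux uy to from = ∼bag⇒↭ (unique∧set⇒bag ux uy (mk⇔ to from))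

pigeonhole : ∀ (r : List A) {σ} → Unique r → length σ ≡ length r →
             (∀ {k} → k ∈ r → k ∈ σ) → σ ↭ r
pigeonhole [] {[]} _ _ _ = ↭-refl
pigeonhole (x ∷ r) {σ} (x∉r ∷ ur) len r⊆σ with ∈⇒↭ (r⊆σ (here refl))
... | σ′ , σ↭ = ↭-trans σ↭ (↭-prep x (pigeonhole r ur len′ r⊆σ′))
  where
  len′ : length σ′ ≡ length r
  len′ = suc-injective (trans (sym (↭-length σ↭)) len)
  r⊆σ′ : ∀ {k} → k ∈ r → k ∈ σ′
  r⊆σ′ k∈r with ∈-resp-↭ σ↭ (r⊆σ (there k∈r))
  ... | here k≡x = ⊥-elim (All.lookup x∉r k∈r (sym k≡x))
  ... | there k∈σ′ = k∈σ′

Unique-map : ∀ {f : A → B} {xs} → (∀ {x y} → x ∈ xs → y ∈ xs → f x ≡ f y → x ≡ y) →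
             Unique xs → Unique (map f xs)
Unique-map {xs = []} inj [] = []
Unique-map {f = f} {xs = x ∷ xs} inj (x∉xs ∷ u) =
  All.map⁺ (All.tabulate (λ {y} y∈xs fx≡fy → All.lookup x∉xs y∈xs (inj (here refl) (there y∈xs) fx≡fy)))
  ∷ Unique-map (λ x∈ y∈ → inj (there x∈) (there y∈)) u

Unique-concatMap : ∀ {g : A → List B} {xs} → Unique xs → (∀ {x} → x ∈ xs → Unique (g x)) →
                   (∀ {x y z} → x ∈ xs → y ∈ xs → z ∈ g x → z ∈ g y → x ≡ y) →
                   Unique (concatMap g xs)
Unique-concatMap [] _ _ = []
Unique-concatMap {g = g} {x ∷ xs} (x∉xs ∷ u) ug disj =
  Unique.++⁺ (ug (here refl)) (Unique-concatMap u (ug ∘ there) (λ x∈ y∈ → disj (there x∈) (there y∈))) apart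
  where
  apart : ∀ {z} → ¬ (z ∈ g x × z ∈ concatMap g xs)
  apart (z∈gx , z∈rest) with find (∈-concatMap⁻ g z∈rest)
  ... | y , y∈xs , z∈gy = All.lookup x∉xs y∈xs (disj (here refl) (there y∈xs) z∈gx z∈gy)

map-++⁻ : ∀ (f : A → B) zs {xs ys} → map f zs ≡ xs ++ ys →
          ∃₂ λ zs₁ zs₂ → zs ≡ zs₁ ++ zs₂ × map f zs₁ ≡ xs × map f zs₂ ≡ ys
map-++⁻ f zs       {[]}     eq = [] , zs , refl , refl , eq
map-++⁻ f (z ∷ zs) {x ∷ xs} eq with map-++⁻ f zs (List.∷-injectiveʳ eq)
... | zs₁ , zs₂ , refl , eq₁ , eq₂ = z ∷ zs₁ , zs₂ , refl , cong₂ _∷_ (List.∷-injectiveˡ eq) eq₁ , eq₂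

take-prefix : ∀ (u v : List A) → take (length u) (u ++ v) ≡ u
take-prefix []      v = refl
take-prefix (x ∷ u) v = cong (x ∷_) (take-prefix u v)

drop-prefix : ∀ (u v : List A) → drop (length u) (u ++ v) ≡ v
drop-prefix []      v = refl
drop-prefix (x ∷ u) v = drop-prefix u v

drop-++-≤ : ∀ i (u v : List A) → i ≤ length u → drop i (u ++ v) ≡ drop i u ++ v
drop-++-≤ zero    u       v _         = refl
drop-++-≤ (suc i) (x ∷ u) v (s≤s i≤u) = drop-++-≤ i u v i≤u

split-at : ∀ i (xs : List A) → i < length xs → ∃₂ λ u c → ∃ λ v → xs ≡ u ++ c ∷ v × length u ≡ i
split-at zero    (x ∷ xs) _ = [] , x , xs , refl , refl
split-at (suc i) (x ∷ xs) (s≤s i<xs) with split-at i xs i<xs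
... | u , c , v , refl , len = x ∷ u , c , v , refl , cong suc len

key-at : ∀ (k : A → ℕ) (f : ℕ → ℕ) P {X Z n} → map k (P ++ X ∷ Z) ≡ applyUpTo f n → k X ≡ f (length P)
key-at k f []      {n = suc n} eq = List.∷-injectiveˡ eq
key-at k f (x ∷ P) {n = suc n} eq = key-at k (f ∘ suc) P (List.∷-injectiveʳ eq)

map-two : ∀ (f : A → B) P Q S u v → map f (P ++ u ∷ Q ++ v ∷ S) ≡ map f P ++ f u ∷ map f Q ++ f v ∷ map f S
map-two f P Q S u v = trans (List.map-++ f P _) (cong (λ Z → map f P ++ f u ∷ Z) (List.map-++ f Q _))

map-two⁻ : ∀ (f : A → B) Z {V₁ c V₂ c′ V₃} → map f Z ≡ V₁ ++ c ∷ V₂ ++ c′ ∷ V₃ →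
  ∃₂ λ Z₁ X → ∃₂ λ Y W → ∃ λ Z₃ → Z ≡ Z₁ ++ X ∷ W ++ Y ∷ Z₃ ×
    map f Z₁ ≡ V₁ × f X ≡ c × map f W ≡ V₂ × f Y ≡ c′
map-two⁻ f Z eq with map-++⁻ f Z eq
... | Z₁ , X ∷ Z′ , refl , eq₁ , eqX with map-++⁻ f Z′ (List.∷-injectiveʳ eqX)
... | W , Y ∷ Z₃ , refl , eqW , eqY =
  Z₁ , X , Y , W , Z₃ , refl , eq₁ , List.∷-injectiveˡ eqX , eqW , List.∷-injectiveˡ eqY

All-two⁻ : ∀ {r} {Pr : A → Set r} P Q S {u v} → All Pr (P ++ u ∷ Q ++ v ∷ S) →
           All Pr P × Pr u × All Pr Q × Pr v × All Pr S
All-two⁻ P Q S all with All.++⁻ P all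
... | allP , (pu ∷ rest) with All.++⁻ Q rest
... | allQ , (pv ∷ allS) = allP , pu , allQ , pv , allS

All-two⁺ : ∀ {r} {Pr : A → Set r} P Q S {u v} →
           All Pr P → Pr u → All Pr Q → Pr v → All Pr S → All Pr (P ++ u ∷ Q ++ v ∷ S)
All-two⁺ P Q S allP pu allQ pv allS = All.++⁺ allP (pu ∷ All.++⁺ allQ (pv ∷ allS))

two-front : ∀ (P Q S : List A) u v → P ++ u ∷ Q ++ v ∷ S ↭ u ∷ v ∷ P ++ Q ++ S
two-front P Q S u v = ↭-trans (shift u P (Q ++ v ∷ S)) (↭-prep u (begin
  P ++ Q ++ v ∷ S     ≡⟨ sym (List.++-assoc P Q (v ∷ S)) ⟩
  (P ++ Q) ++ v ∷ S   ↭⟨ shift v (P ++ Q) S ⟩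
  v ∷ (P ++ Q) ++ S   ≡⟨ cong (v ∷_) (List.++-assoc P Q S) ⟩
  v ∷ P ++ Q ++ S     ∎))
  where open PermutationReasoning

exchange-↭ : ∀ (P Q S : List A) u v → P ++ u ∷ Q ++ v ∷ S ↭ P ++ v ∷ Q ++ u ∷ S
exchange-↭ P Q S u v = ↭-trans (two-front P Q S u v) (↭-trans (↭-swap u v ↭-refl) (↭-sym (two-front P Q S v u)))

two-distinct : ∀ (P Q S : List A) {u v} → Unique (P ++ u ∷ Q ++ v ∷ S) → u ≢ v × All (u ≢_) Q × All (_≢ v) Q
two-distinct P Q S {u} {v} uniq with Unique-resp-↭ (two-front P Q S u v) uniq
... | u∉ ∷ v∉ ∷ _ = All.head u∉ ,
                    All.++⁻ˡ Q (All.++⁻ʳ P (All.tail u∉)) ,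
                    All.map (λ v≢ q≡v → v≢ (sym q≡v)) (All.++⁻ˡ Q (All.++⁻ʳ P v∉))

cart : List (List A) → List (List A)
cart []       = [ [] ]
cart (F ∷ Fs) = concatMap (λ x → map (x ∷_) (cart Fs)) F

∈-cart⁻ : ∀ (Fs : List (List A)) {μ} → μ ∈ cart Fs → Pointwise _∈_ μ Fs
∈-cart⁻ []       (here refl) = []
∈-cart⁻ (F ∷ Fs) μ∈ with find (∈-concatMap⁻ (λ x → map (x ∷_) (cart Fs)) {xs = F} μ∈)
... | x , x∈F , μ∈′ with ∈-map⁻ (x ∷_) μ∈′
... | ν , ν∈ , refl = x∈F ∷ ∈-cart⁻ Fs ν∈

∈-cart⁺ : ∀ (Fs : List (List A)) {μ} → Pointwise _∈_ μ Fs → μ ∈ cart Fs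
∈-cart⁺ []       []             = here refl
∈-cart⁺ (F ∷ Fs) (x∈F ∷ μ∈Fs) =
  ∈-concatMap⁺ (λ y → map (y ∷_) (cart Fs)) (Any.map (λ { refl → ∈-map⁺ (_ ∷_) (∈-cart⁺ Fs μ∈Fs) }) x∈F)

Unique-cart : ∀ (Fs : List (List A)) → All Unique Fs → Unique (cart Fs)
Unique-cart []       _          = [] ∷ []
Unique-cart (F ∷ Fs) (uF ∷ uFs) =
  Unique-concatMap uF (λ _ → Unique.map⁺ List.∷-injectiveʳ (Unique-cart Fs uFs)) sameHead
  where
  sameHead : ∀ {x y z} → x ∈ F → y ∈ F → z ∈ map (x ∷_) (cart Fs) → z ∈ map (y ∷_) (cart Fs) → x ≡ y
  sameHead _ _ z∈x z∈y with ∈-map⁻ _ z∈x | ∈-map⁻ _ z∈y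
  ... | _ , _ , refl | _ , _ , eq = List.∷-injectiveˡ eq

distinct⁻ : ∀ v → T (distinct v) → Unique v
distinct⁻ []      _ = []
distinct⁻ (x ∷ r) t with Equivalence.to T-∧ t
... | fresh , t′ = All.tabulate (λ y∈r x≡y → T-not⁻ fresh (any⁺ (x ≡ᵇ_) (x-occurs (subst (_∈ r) (sym x≡y) y∈r))))
                   ∷ distinct⁻ r t′
  where
  x-occurs : x ∈ r → Any.Any (λ y → T (x ≡ᵇ y)) r
  x-occurs = Any.map (λ { refl → ≡⇒≡ᵇ x x refl })

distinct⁺ : ∀ v → Unique v → T (distinct v)
distinct⁺ []      _           = tt
distinct⁺ (x ∷ r) (x∉r ∷ ur) = Equivalence.from T-∧ (T-not⁺ repeated , distinct⁺ r ur)
  where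
  repeated : ¬ T (or (map (x ≡ᵇ_) r))
  repeated t with find (any⁻ (x ≡ᵇ_) r t)
  ... | y , y∈r , x≡ᵇy = All.lookup x∉r y∈r (≡ᵇ⇒≡ x y x≡ᵇy)

distinct-↭ : ∀ {v v′} → v ↭ v′ → distinct v ≡ distinct v′
distinct-↭ {v} {v′} p = T-ext (λ t → distinct⁺ v′ (Unique-resp-↭ p (distinct⁻ v t)))
                              (λ t → distinct⁺ v (Unique-resp-↭ (↭-sym p) (distinct⁻ v′ t)))

findᵇ-just : ∀ (p : A → Bool) xs {j} → findᵇ p xs ≡ just j → j ∈ xs × T (p j)
findᵇ-just p (x ∷ xs) found with p x in px
findᵇ-just p (x ∷ xs) refl  | true  = here refl , Equivalence.from T-≡ px
findᵇ-just p (x ∷ xs) found | false = let j∈ , pj = findᵇ-just p xs found in there j∈ , pj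

findᵇ-violation : ∀ (f : A → Bool) xs → ¬ T (all f xs) → ∃ λ j → findᵇ (not ∘ f) xs ≡ just j
findᵇ-violation f []       ¬all = ⊥-elim (¬all tt)
findᵇ-violation f (x ∷ xs) ¬all with f x
... | false = x , refl
... | true  = findᵇ-violation f xs ¬all

findᵇ-violation⁻ : ∀ (f : A → Bool) xs {j} → findᵇ (not ∘ f) xs ≡ just j → ¬ T (all f xs)
findᵇ-violation⁻ f xs found fs with findᵇ-just (not ∘ f) xs found
... | j∈ , ¬fj = T-not⁻ ¬fj (All.lookup (All.all⁺ f xs fs) j∈)

findᵇ-stable : ∀ (p p′ : ℕ → Bool) xs {j} → AllPairs _<_ xs → findᵇ p xs ≡ just j →
               (∀ {t} → t ∈ xs → t ≤ j → p′ t ≡ p t) → findᵇ p′ xs ≡ just j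
findᵇ-stable p p′ (x ∷ xs) (x< ∷ increasing) found agree with p x in px
findᵇ-stable p p′ (x ∷ xs) (x< ∷ increasing) refl  agree | true
  rewrite agree (here refl) ≤-refl | px = refl
... | false rewrite agree (here refl) (<⇒≤ (All.lookup x< (proj₁ (findᵇ-just p xs found)))) | px =
  findᵇ-stable p p′ xs increasing found (agree ∘ there)

position : ℕ → List ℕ → ℕ
position x []      = 0
position x (y ∷ r) = if x ≡ᵇ y then 0 else suc (position x r)

position-spec : ∀ x r → T (or (map (x ≡ᵇ_) r)) → ∃₂ λ V W → r ≡ V ++ x ∷ W × position x r ≡ length V
position-spec x (y ∷ r) occurs with x ≡ᵇ y in x≡ᵇy
... | true  = [] , r , cong (_∷ r) (sym (≡ᵇ⇒≡ x y (Equivalence.from T-≡ x≡ᵇy))) , refl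
... | false with position-spec x r occurs
... | V , W , refl , pos = y ∷ V , W , refl , cong suc pos

-- The first entry of v that occurs again later, as the pair (its position,
-- the number of entries strictly between its first two occurrences)
firstRepeat : List ℕ → Maybe (ℕ × ℕ)
firstRepeat []      = nothing
firstRepeat (x ∷ r) = if or (map (x ≡ᵇ_) r) then just (0 , position x r) else Maybe.map (map₁ suc) (firstRepeat r)

firstRepeat-spec : ∀ v {a d} → firstRepeat v ≡ just (a , d) →
                   ∃₂ λ V₁ c → ∃₂ λ V₂ V₃ → v ≡ V₁ ++ c ∷ V₂ ++ c ∷ V₃ × length V₁ ≡ a × length V₂ ≡ d
firstRepeat-spec (x ∷ r) found with or (map (x ≡ᵇ_) r) in repeated
firstRepeat-spec (x ∷ r) refl | true with position-spec x r (Equivalence.from T-≡ repeated)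
... | V₂ , V₃ , refl , pos = [] , x , V₂ , V₃ , refl , refl , sym pos
firstRepeat-spec (x ∷ r) found | false with firstRepeat r in later
firstRepeat-spec (x ∷ r) refl  | false | just _ with firstRepeat-spec r later
... | V₁ , c , V₂ , V₃ , refl , len₁ , len₂ = x ∷ V₁ , c , V₂ , V₃ , refl , cong suc len₁ , len₂

firstRepeat-exists : ∀ v → ¬ T (distinct v) → ∃ λ ad → firstRepeat v ≡ just ad
firstRepeat-exists []      ¬distinct = ⊥-elim (¬distinct tt)
firstRepeat-exists (x ∷ r) ¬distinct with or (map (x ≡ᵇ_) r)
... | true  = _ , refl
... | false with firstRepeat r | firstRepeat-exists r ¬distinct
... | just _ | _ = _ , refl

count : (A → Bool) → List A → ℕ
count p xs = length (filter (λ x → T? (p x)) xs)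

count-↭ : ∀ (p : A → Bool) {xs ys} → xs ↭ ys → count p xs ≡ count p ys
count-↭ p xs↭ys = ↭-length (filter-↭ (λ x → T? (p x)) xs↭ys)

count-map : ∀ (p : B → Bool) (f : A → B) xs → count p (map f xs) ≡ count (p ∘ f) xs
count-map p f []       = refl
count-map p f (x ∷ xs) with p (f x)
... | true  = cong suc (count-map p f xs)
... | false = count-map p f xs

count-cong : ∀ {p q : A → Bool} xs → (∀ {x} → x ∈ xs → p x ≡ q x) → count p xs ≡ count q xs
count-cong []       _     = refl
count-cong {p = p} {q} (x ∷ xs) p≡q with p x | q x | p≡q (here refl)
... | true  | true  | _ = cong suc (count-cong xs (p≡q ∘ there))
... | false | false | _ = count-cong xs (p≡q ∘ there)

count-∷ : ∀ (p : A → Bool) x xs → count p (x ∷ xs) ≡ count p [ x ] + count p xs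
count-∷ p x xs with p x
... | true  = refl
... | false = refl

count-[] : ∀ (p : A → Bool) (q : B → Bool) {x y} → p x ≡ q y → count p [ x ] ≡ count q [ y ]
count-[] p q {x} {y} px≡qy with p x | q y
... | true  | true  = refl
... | false | false = refl

pairs : (A → A → Bool) → List A → ℕ
pairs c []       = 0
pairs c (x ∷ xs) = count (c x) xs + pairs c xs

pairs-cong : ∀ {c d : A → A → Bool} → (∀ x y → c x y ≡ d x y) → ∀ xs → pairs c xs ≡ pairs d xs
pairs-cong c≡d []       = refl
pairs-cong c≡d (x ∷ xs) = cong₂ _+_ (count-cong xs (λ {y} _ → c≡d x y)) (pairs-cong c≡d xs)

pairs-↭ : ∀ (c : A → A → Bool) → (∀ x y → c x y ≡ c y x) → ∀ {xs ys} → xs ↭ ys → pairs c xs ≡ pairs c ys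
pairs-↭ c sym-c ↭.refl        = refl
pairs-↭ c sym-c (↭.prep x p)  = cong₂ _+_ (count-↭ (c x) p) (pairs-↭ c sym-c p)
pairs-↭ c sym-c (↭.trans p q) = trans (pairs-↭ c sym-c p) (pairs-↭ c sym-c q)
pairs-↭ c sym-c (↭.swap {xs} {ys} x y p) = begin
  count (c x) (y ∷ xs) + (count (c y) xs + pairs c xs)
    ≡⟨ cong₂ (λ u v → u + (count (c y) xs + v)) (count-∷ (c x) y xs) (pairs-↭ c sym-c p) ⟩
  (count (c x) [ y ] + count (c x) xs) + (count (c y) xs + pairs c ys)
    ≡⟨ cong₂ (λ u v → (u + v) + (count (c y) xs + pairs c ys)) (count-[] (c x) (c y) (sym-c x y)) (count-↭ (c x) p) ⟩
  (count (c y) [ x ] + cx) + (count (c y) xs + pairs c ys)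
    ≡⟨ cong (λ u → (count (c y) [ x ] + cx) + (u + pairs c ys)) (count-↭ (c y) p) ⟩
  (k + cx) + (cy + r)   ≡⟨ ℕₚ.+-assoc k cx (cy + r) ⟩
  k + (cx + (cy + r))   ≡⟨ cong (k +_) (x∙yz≈y∙xz cx cy r) ⟩
  k + (cy + (cx + r))   ≡⟨ sym (ℕₚ.+-assoc k cy (cx + r)) ⟩
  (k + cy) + (cx + r)   ≡⟨ cong (_+ (cx + r)) (sym (count-∷ (c y) x ys)) ⟩
  count (c y) (x ∷ ys) + (count (c x) ys + pairs c ys) ∎
  where
  open ≡-Reasoning
  k = count (c y) [ x ]
  cx = count (c x) ys
  cy = count (c y) ys
  r = pairs c ys

crossing : (A → ℕ) → (A → ℕ) → A → A → Bool
crossing k₁ k₂ x y = ((k₁ y <ᵇ k₁ x) ∧ (k₂ x <ᵇ k₂ y)) ∨ ((k₁ x <ᵇ k₁ y) ∧ (k₂ y <ᵇ k₂ x))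

crossing-sym : ∀ (k₁ k₂ : A → ℕ) x y → crossing k₁ k₂ x y ≡ crossing k₁ k₂ y x
crossing-sym k₁ k₂ x y = ∨-comm ((k₁ y <ᵇ k₁ x) ∧ (k₂ x <ᵇ k₂ y)) ((k₁ x <ᵇ k₁ y) ∧ (k₂ y <ᵇ k₂ x))

crossing-swap : ∀ (k₁ k₂ : A → ℕ) x y → crossing k₁ k₂ x y ≡ crossing k₂ k₁ x y
crossing-swap k₁ k₂ x y = trans
  (cong₂ _∨_ (∧-comm (k₁ y <ᵇ k₁ x) (k₂ x <ᵇ k₂ y)) (∧-comm (k₁ x <ᵇ k₁ y) (k₂ y <ᵇ k₂ x)))
  (∨-comm ((k₂ x <ᵇ k₂ y) ∧ (k₁ y <ᵇ k₁ x)) ((k₂ y <ᵇ k₂ x) ∧ (k₁ x <ᵇ k₁ y)))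

pairs-crossing : ∀ (k₁ k₂ : A → ℕ) L → AllPairs (λ x y → k₁ x < k₁ y) L →
                 pairs (crossing k₁ k₂) L ≡ inversions (map k₂ L)
pairs-crossing k₁ k₂ []      []              = refl
pairs-crossing k₁ k₂ (x ∷ L) (x<L ∷ increasing) =
  cong₂ _+_ (trans (count-cong L crossing-x) (sym (count-map (λ k → k <ᵇ k₂ x) k₂ L)))
            (pairs-crossing k₁ k₂ L increasing)
  where
  crossing-x : ∀ {y} → y ∈ L → crossing k₁ k₂ x y ≡ (k₂ y <ᵇ k₂ x)
  crossing-x y∈L rewrite <ᵇ-false (<⇒≤ (All.lookup x<L y∈L)) | <ᵇ-true (All.lookup x<L y∈L) = refl

isEven-suc : ∀ n → isEven (suc n) ≡ not (isEven n)
isEven-suc zero          = refl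
isEven-suc (suc zero)    = refl
isEven-suc (suc (suc n)) = isEven-suc n

isEven-+-opposite : ∀ k {m n} → isEven n ≡ not (isEven m) → isEven (k + n) ≡ not (isEven (k + m))
isEven-+-opposite zero    opp = opp
isEven-+-opposite (suc k) {m} {n} opp = begin
  isEven (suc (k + n))     ≡⟨ isEven-suc (k + n) ⟩
  not (isEven (k + n))     ≡⟨ cong not (isEven-+-opposite k opp) ⟩
  not (not (isEven (k + m))) ≡⟨ cong not (sym (isEven-suc (k + m))) ⟩
  not (isEven (suc (k + m))) ∎
  where open ≡-Reasoning

inversions-adjacent : ∀ P {x y} S → x ≢ y →
                      isEven (inversions (P ++ y ∷ x ∷ S)) ≡ not (isEven (inversions (P ++ x ∷ y ∷ S)))
inversions-adjacent (z ∷ P) {x} {y} S x≢y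
  rewrite count-↭ (λ w → w <ᵇ z) (++⁺ˡ P (↭-swap y x (↭-refl {x = S}))) =
  isEven-+-opposite (count (λ w → w <ᵇ z) (P ++ x ∷ y ∷ S)) (inversions-adjacent P S x≢y)
inversions-adjacent [] {x} {y} S x≢y with <-cmp x y
... | tri< x<y _ _ rewrite <ᵇ-true x<y | <ᵇ-false (<⇒≤ x<y) =
  trans (isEven-suc (cy + (cx + I))) (cong (not ∘ isEven) (x∙yz≈y∙xz cy cx I))
  where cx = count (λ w → w <ᵇ x) S ; cy = count (λ w → w <ᵇ y) S ; I = inversions S
... | tri≈ _ x≡y _ = ⊥-elim (x≢y x≡y)
... | tri> _ _ y<x rewrite <ᵇ-true y<x | <ᵇ-false (<⇒≤ y<x) = begin
  isEven (cy + (cx + I))             ≡⟨ sym (not-involutive _) ⟩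
  not (not (isEven (cy + (cx + I)))) ≡⟨ cong (not ∘ not ∘ isEven) (x∙yz≈y∙xz cy cx I) ⟩
  not (not (isEven (cx + (cy + I)))) ≡⟨ cong not (sym (isEven-suc (cx + (cy + I)))) ⟩
  not (isEven (suc (cx + (cy + I))))  ∎
  where open ≡-Reasoning
        cx = count (λ w → w <ᵇ x) S ; cy = count (λ w → w <ᵇ y) S ; I = inversions S

-- Exchanging two distinct entries u, v (separated by Q, all distinct from both)
-- changes the parity of the inversions: it is a product of 2·|Q|+1 adjacent exchanges.
inversions-transpose : ∀ P Q S {u v} → u ≢ v → All (u ≢_) Q → All (_≢ v) Q →
                       isEven (inversions (P ++ v ∷ Q ++ u ∷ S)) ≡ not (isEven (inversions (P ++ u ∷ Q ++ v ∷ S)))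
inversions-transpose P []      S u≢v []          []          = inversions-adjacent P S u≢v
inversions-transpose P (q ∷ Q) S {u} {v} u≢v (u≢q ∷ u≢Q) (q≢v ∷ Q≢v) = begin
  isEven (inversions (P ++ v ∷ q ∷ Q ++ u ∷ S))
    ≡⟨ inversions-adjacent P (Q ++ u ∷ S) q≢v ⟩
  not (isEven (inversions (P ++ q ∷ v ∷ Q ++ u ∷ S)))
    ≡⟨ cong (not ∘ isEven ∘ inversions) (sym (List.++-assoc P [ q ] (v ∷ Q ++ u ∷ S))) ⟩
  not (isEven (inversions ((P ++ [ q ]) ++ v ∷ Q ++ u ∷ S)))
    ≡⟨ cong not (inversions-transpose (P ++ [ q ]) Q S u≢v u≢Q Q≢v) ⟩
  not (not (isEven (inversions ((P ++ [ q ]) ++ u ∷ Q ++ v ∷ S))))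
    ≡⟨ not-involutive _ ⟩
  isEven (inversions ((P ++ [ q ]) ++ u ∷ Q ++ v ∷ S))
    ≡⟨ cong (isEven ∘ inversions) (List.++-assoc P [ q ] (u ∷ Q ++ v ∷ S)) ⟩
  isEven (inversions (P ++ q ∷ u ∷ Q ++ v ∷ S))
    ≡⟨ inversions-adjacent P (Q ++ v ∷ S) u≢q ⟩
  not (isEven (inversions (P ++ u ∷ q ∷ Q ++ v ∷ S))) ∎
  where open ≡-Reasoning

∈-range⁻ : ∀ {m x} → x ∈ range m → 1 ≤ x × x ≤ m
∈-range⁻ x∈ with ∈-applyUpTo⁻ suc x∈
... | i , i<m , refl = s≤s z≤n , i<m

range-increasing : ∀ m → AllPairs _<_ (range m)
range-increasing m = AllPairsₚ.applyUpTo⁺₁ suc m (λ i<j _ → s≤s i<j)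

Unique-range : ∀ m → Unique (range m)
Unique-range m = AllPairs.map ℕₚ.<⇒≢ (range-increasing m)

length-range : ∀ m → length (range m) ≡ m
length-range = List.length-applyUpTo suc

range-suc : ∀ k → range (suc k) ≡ range k ++ [ suc k ]
range-suc k = sym (List.applyUpTo-∷ʳ suc k)

parts-of : ∀ σ → map (λ i → part i σ) (range (length σ)) ≡ σ
parts-of σ = trans (List.map-applyUpTo suc (λ i → part i σ) (length σ)) (read σ)
  where
  read : ∀ σ → applyUpTo (λ i → part (suc i) σ) (length σ) ≡ σ
  read []      = refl
  read (x ∷ σ) = cong (x ∷_) (read σ)

parts-of-↭ : ∀ {m σ} → σ ↭ range m → map (λ i → part i σ) (range m) ≡ σ
parts-of-↭ {m} {σ} σ↭ =
  trans (cong (λ k → map (λ i → part i σ) (range k)) (sym (trans (↭-length σ↭) (length-range m)))) (parts-of σ)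

allLists≡cart : ∀ i m → allLists i m ≡ cart (replicate i (range m))
allLists≡cart zero    m = refl
allLists≡cart (suc i) m = cong (λ L → concatMap (λ x → map (x ∷_) L) (range m)) (allLists≡cart i m)

Pointwise-replicate⁻ : ∀ {r} {R : A → B → Set r} i {y xs} → Pointwise R xs (replicate i y) →
                       length xs ≡ i × All (λ x → R x y) xs
Pointwise-replicate⁻ zero    []           = refl , []
Pointwise-replicate⁻ (suc i) (Rxy ∷ Rxsy) = let len , all = Pointwise-replicate⁻ i Rxsy in cong suc len , Rxy ∷ all

Pointwise-replicate⁺ : ∀ {r} {R : A → B → Set r} i {y xs} → length xs ≡ i → All (λ x → R x y) xs →
                       Pointwise R xs (replicate i y)
Pointwise-replicate⁺ zero    {xs = []} _   []           = []
Pointwise-replicate⁺ (suc i) {xs = _ ∷ _} len (Rxy ∷ all) = Rxy ∷ Pointwise-replicate⁺ i (suc-injective len) all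

∈-allLists⁻ : ∀ i m {xs} → xs ∈ allLists i m → length xs ≡ i × All (_∈ range m) xs
∈-allLists⁻ i m xs∈ = Pointwise-replicate⁻ i (∈-cart⁻ (replicate i (range m)) (subst (_ ∈_) (allLists≡cart i m) xs∈))

∈-allLists⁺ : ∀ i m {xs} → length xs ≡ i → All (_∈ range m) xs → xs ∈ allLists i m
∈-allLists⁺ i m len bounded =
  subst (_ ∈_) (sym (allLists≡cart i m)) (∈-cart⁺ (replicate i (range m)) (Pointwise-replicate⁺ i len bounded))

Unique-allLists : ∀ i m → Unique (allLists i m)
Unique-allLists i m = subst Unique (sym (allLists≡cart i m))
                        (Unique-cart (replicate i (range m)) (All.replicate⁺ i (Unique-range m)))

isPerm⁻ : ∀ m σ → T (isPerm m σ) → σ ↭ range m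
isPerm⁻ m σ t with Equivalence.to T-∧ t
... | len , covers = pigeonhole (range m) (Unique-range m) (trans (≡ᵇ⇒≡ _ m len) (sym (length-range m))) occurs
  where
  occurs : ∀ {k} → k ∈ range m → k ∈ σ
  occurs k∈ with find (any⁻ (λ x → x ≡ᵇ _) σ (All.lookup (All.all⁺ _ (range m) covers) k∈))
  ... | x , x∈σ , x≡ᵇk = subst (_∈ σ) (≡ᵇ⇒≡ x _ x≡ᵇk) x∈σ

isPerm⁺ : ∀ m σ → σ ↭ range m → T (isPerm m σ)
isPerm⁺ m σ σ↭ = Equivalence.from T-∧
  ( ≡⇒≡ᵇ (length σ) m (trans (↭-length σ↭) (length-range m))
  , All.all⁻ _ (All.tabulate (λ {k} k∈ → any⁺ (λ x → x ≡ᵇ k)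
                                               (Any.map (λ { refl → ≡⇒≡ᵇ k k refl }) (∈-resp-↭ (↭-sym σ↭) k∈)))))

∈-perms⁻ : ∀ {m σ} → σ ∈ perms m → σ ↭ range m
∈-perms⁻ {m} {σ} σ∈ = isPerm⁻ m σ (proj₂ (∈-filter⁻ (λ σ → T? (isPerm m σ)) {xs = allLists m m} σ∈))

∈-perms⁺ : ∀ {m σ} → σ ↭ range m → σ ∈ perms m
∈-perms⁺ {m} {σ} σ↭ = ∈-filter⁺ (λ σ → T? (isPerm m σ))
  (∈-allLists⁺ m m (trans (↭-length σ↭) (length-range m)) (All.tabulate (∈-resp-↭ σ↭))) (isPerm⁺ m σ σ↭)

Unique-perms : ∀ m → Unique (perms m)
Unique-perms m = Unique.filter⁺ (λ σ → T? (isPerm m σ)) (Unique-allLists m m)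

pick : (List ℕ → ℕ) → ℕ → List (List ℕ) → List ℕ
pick k i []      = []
pick k i (x ∷ L) = if k x ≡ᵇ i then x else pick k i L

pick-∈ : ∀ k {i} L → i ∈ map k L → pick k i L ∈ L × k (pick k i L) ≡ i
pick-∈ k {i} (x ∷ L) i∈ with k x ≡ᵇ i in eq | i∈
... | true  | _          = here refl , ≡ᵇ⇒≡ _ _ (Equivalence.from T-≡ eq)
... | false | here i≡kx  = ⊥-elim (subst T eq (≡⇒≡ᵇ _ _ (sym i≡kx)))
... | false | there i∈′  = let p∈ , key = pick-∈ k L i∈′ in there p∈ , key

pick-unique : ∀ k L {x} → Unique (map k L) → x ∈ L → pick k (k x) L ≡ x
pick-unique k (y ∷ L) {x} (y∉ ∷ u) x∈ with k y ≡ᵇ k x in eq | x∈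
... | true  | here refl  = refl
... | true  | there x∈′ = ⊥-elim (All.lookup y∉ (∈-map⁺ k x∈′) (≡ᵇ⇒≡ _ _ (Equivalence.from T-≡ eq)))
... | false | here refl  = ⊥-elim (subst T eq (≡⇒≡ᵇ (k y) (k y) refl))
... | false | there x∈′ = pick-unique k L u x∈′

sortBy : ℕ → (List ℕ → ℕ) → List (List ℕ) → List (List ℕ)
sortBy m k L = map (λ i → pick k i L) (range m)

module _ {m : ℕ} {k : List ℕ → ℕ} {L : List (List ℕ)} (keys↭ : map k L ↭ range m) where

  private
    unique-keys : Unique (map k L)
    unique-keys = Unique-resp-↭ (↭-sym keys↭) (Unique-range m)

  sortBy-keys : map k (sortBy m k L) ≡ range m
  sortBy-keys = trans (sym (List.map-∘ (range m)))
    (trans (List.map-cong-local (All.tabulate (λ i∈ → proj₂ (pick-∈ k L (∈-resp-↭ (↭-sym keys↭) i∈)))))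
           (List.map-id (range m)))

  sortBy-↭ : sortBy m k L ↭ L
  sortBy-↭ = unique-↭ (Unique.map⁻ (subst Unique (sym sortBy-keys) (Unique-range m))) (Unique.map⁻ unique-keys)
    picked listed
    where
    picked : ∀ {x} → x ∈ sortBy m k L → x ∈ L
    picked x∈ with ∈-map⁻ (λ i → pick k i L) x∈
    ... | i , i∈ , refl = proj₁ (pick-∈ k L (∈-resp-↭ (↭-sym keys↭) i∈))
    listed : ∀ {x} → x ∈ L → x ∈ sortBy m k L
    listed x∈ = subst (_∈ sortBy m k L) (pick-unique k L unique-keys x∈)
                      (∈-map⁺ (λ i → pick k i L) (∈-resp-↭ keys↭ (∈-map⁺ k x∈)))

sortBy-reindex : ∀ {m} k {L S} → map k L ≡ range m → S ↭ L → sortBy m k S ≡ L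
sortBy-reindex {m} k {L} {S} keys S↭L = begin
  map (λ i → pick k i S) (range m)        ≡⟨ cong (map (λ i → pick k i S)) (sym keys) ⟩
  map (λ i → pick k i S) (map k L)        ≡⟨ sym (List.map-∘ L) ⟩
  map (λ x → pick k (k x) S) L            ≡⟨ List.map-cong-local (All.tabulate picks-itself) ⟩
  map (λ x → x) L                         ≡⟨ List.map-id L ⟩
  L                                       ∎
  where
  open ≡-Reasoning
  unique-keys : Unique (map k S)
  unique-keys = Unique-resp-↭ (map⁺ k (↭-sym S↭L)) (subst Unique (sym keys) (Unique-range m))
  picks-itself : ∀ {x} → x ∈ L → pick k (k x) S ≡ x
  picks-itself x∈ = pick-unique k S unique-keys (∈-resp-↭ (↭-sym S↭L) x∈)

-- Re-listing by the second key turns the inversions of the second keys into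
-- inversions of the first keys: both count the pairs ordered oppositely by the two keys.
sortBy-inversions : ∀ {m} (k₁ k₂ : List ℕ → ℕ) {L} → map k₁ L ≡ range m → (keys↭ : map k₂ L ↭ range m) →
                    inversions (map k₁ (sortBy m k₂ L)) ≡ inversions (map k₂ L)
sortBy-inversions {m} k₁ k₂ {L} keys₁ keys↭ = begin
  inversions (map k₁ S)       ≡⟨ sym (pairs-crossing k₂ k₁ S (increasing k₂ S (sortBy-keys keys↭))) ⟩
  pairs (crossing k₂ k₁) S    ≡⟨ pairs-cong (crossing-swap k₂ k₁) S ⟩
  pairs (crossing k₁ k₂) S    ≡⟨ pairs-↭ (crossing k₁ k₂) (crossing-sym k₁ k₂) (sortBy-↭ keys↭) ⟩
  pairs (crossing k₁ k₂) L    ≡⟨ pairs-crossing k₁ k₂ L (increasing k₁ L keys₁) ⟩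
  inversions (map k₂ L)       ∎
  where
  open ≡-Reasoning
  S = sortBy m k₂ L
  increasing : ∀ k X → map k X ≡ range m → AllPairs (λ x y → k x < k y) X
  increasing k X keys = AllPairsₚ.map⁻ (subst (AllPairs _<_) (sym keys) (range-increasing m))

weaklyDecreasing-split : ∀ (u : List ℕ) c v →
  weaklyDecreasing (u ++ c ∷ v) ≡ weaklyDecreasing (u ++ [ c ]) ∧ weaklyDecreasing (c ∷ v)
weaklyDecreasing-split []           c v = refl
weaklyDecreasing-split (x ∷ [])     c v = cong (_∧ weaklyDecreasing (c ∷ v)) (sym (∧-identityʳ (not (x <ᵇ c))))
weaklyDecreasing-split (x ∷ y ∷ u) c v =
  trans (cong (not (x <ᵇ y) ∧_) (weaklyDecreasing-split (y ∷ u) c v)) (sym (∧-assoc (not (x <ᵇ y)) _ _))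

compatGo-++ : ∀ g k (u v : List ℕ) → compatGo g k (u ++ v) ≡ compatGo g k u ∧ compatGo g (k + length u) v
compatGo-++ g k []      v = cong (λ i → compatGo g i v) (sym (ℕₚ.+-identityʳ k))
compatGo-++ g k (y ∷ u) v = trans
  (cong ((ones g k <ᵇ y) ∧_) (trans (compatGo-++ g (suc k) u v)
                                    (cong (λ i → compatGo g (suc k) u ∧ compatGo g i v) (sym (ℕₚ.+-suc k (length u))))))
  (sym (∧-assoc (ones g k <ᵇ y) _ _))

compatGo-drop : ∀ g (Z : List ℕ) → All (1 ≤_) Z → compatGo g 1 (drop 1 Z) ≡ compatGo g 0 Z
compatGo-drop g []          _ = refl
compatGo-drop g (suc z ∷ Z) _ = refl
compatGo-drop g (zero ∷ Z) (() ∷ _)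

compatible-split : ∀ g (u : List ℕ) c v → All (1 ≤_) (u ++ c ∷ v) →
  isCompatiblePartition g (u ++ c ∷ v) ≡
  (weaklyDecreasing (u ++ [ c ]) ∧ weaklyDecreasing (c ∷ v)) ∧ (compatGo g 0 (u ++ [ c ]) ∧ compatGo g (length (u ++ [ c ])) v)
compatible-split g u c v positive = cong₂ _∧_ (weaklyDecreasing-split u c v)
  (trans (compatGo-drop g (u ++ c ∷ v) positive)
         (trans (cong (compatGo g 0) (sym (List.++-assoc u [ c ] v))) (compatGo-++ g 0 (u ++ [ c ]) v)))

T-∧⁴⁻ : ∀ w x y z → T ((w ∧ x) ∧ (y ∧ z)) → T w × T x × T y × T z
T-∧⁴⁻ true true true true _ = tt , tt , tt , tt

T-∧⁴⁺ : ∀ w x y z → T w → T x → T y → T z → T ((w ∧ x) ∧ (y ∧ z))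
T-∧⁴⁺ true true true true _ _ _ _ = tt

compatible⁻ : ∀ g (u : List ℕ) c v → All (1 ≤_) (u ++ c ∷ v) → T (isCompatiblePartition g (u ++ c ∷ v)) →
  T (weaklyDecreasing (u ++ [ c ])) × T (weaklyDecreasing (c ∷ v)) ×
  T (compatGo g 0 (u ++ [ c ])) × T (compatGo g (length (u ++ [ c ])) v)
compatible⁻ g u c v positive compat =
  T-∧⁴⁻ _ _ _ _ (subst T (compatible-split g u c v positive) compat)

compatible⁺ : ∀ g (u : List ℕ) c v → All (1 ≤_) (u ++ c ∷ v) →
  T (weaklyDecreasing (u ++ [ c ])) → T (weaklyDecreasing (c ∷ v)) →
  T (compatGo g 0 (u ++ [ c ])) → T (compatGo g (length (u ++ [ c ])) v) →
  T (isCompatiblePartition g (u ++ c ∷ v))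
compatible⁺ g u c v positive wd₁ wd₂ cg₁ cg₂ =
  subst T (sym (compatible-split g u c v positive)) (T-∧⁴⁺ _ _ _ _ wd₁ wd₂ cg₁ cg₂)

compatible-splice : ∀ g (u u′ : List ℕ) c v v′ → length u ≡ length u′ →
  All (1 ≤_) (u ++ c ∷ v) → All (1 ≤_) (u′ ++ c ∷ v′) → All (1 ≤_) (u′ ++ c ∷ v) →
  T (isCompatiblePartition g (u ++ c ∷ v)) → T (isCompatiblePartition g (u′ ++ c ∷ v′)) →
  T (isCompatiblePartition g (u′ ++ c ∷ v))
compatible-splice g u u′ c v v′ |u|≡|u′| pos pos′ pos″ compat compat′
  with compatible⁻ g u c v pos compat | compatible⁻ g u′ c v′ pos′ compat′
... | _ , tail-wd , _ , tail-cg | head-wd′ , _ , head-cg′ , _ =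
  compatible⁺ g u′ c v pos″ head-wd′ tail-wd head-cg′ (subst (λ i → T (compatGo g i v)) same-position tail-cg)
  where
  same-position : length (u ++ [ c ]) ≡ length (u′ ++ [ c ])
  same-position = trans (List.length-++ u) (trans (cong (_+ 1) |u|≡|u′|) (sym (List.length-++ u′)))

module Tableaux (n : ℕ) (γ : Vec Bool n) where

  m : ℕ
  m = suc n

  Admissible : List ℕ → Set
  Admissible λ′ = All (_∈ range m) λ′ × T (isCompatiblePartition (toList γ) λ′)

  ∈-compatParts⁻ : ∀ {i λ′} → λ′ ∈ compatParts n γ i → length λ′ ≡ i × Admissible λ′
  ∈-compatParts⁻ {i} λ∈ with ∈-filter⁻ (λ λ′ → T? (isCompatiblePartition (toList γ) λ′)) {xs = allLists i m} λ∈
  ... | λ∈′ , compatible with ∈-allLists⁻ i m λ∈′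
  ... | len , bounded = len , bounded , compatible

  ∈-compatParts⁺ : ∀ {i λ′} → length λ′ ≡ i → Admissible λ′ → λ′ ∈ compatParts n γ i
  ∈-compatParts⁺ {i} len (bounded , compatible) =
    ∈-filter⁺ (λ λ′ → T? (isCompatiblePartition (toList γ) λ′)) (∈-allLists⁺ i m len bounded) compatible

  Unique-compatParts : ∀ i → Unique (compatParts n γ i)
  Unique-compatParts i = Unique.filter⁺ (λ λ′ → T? (isCompatiblePartition (toList γ) λ′)) (Unique-allLists i m)

  ∈-seqs⁻ : ∀ k {R} → R ∈ seqs n γ k → All Admissible R × map length R ≡ range k
  ∈-seqs⁻ zero    (here refl) = [] , refl
  ∈-seqs⁻ (suc k) z∈
    with find (∈-concatMap⁻ (λ R → map (λ l → R ++ [ l ]) (compatParts n γ (suc k))) {xs = seqs n γ k} z∈)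
  ... | R , R∈ , z∈′ with ∈-map⁻ (λ l → R ++ [ l ]) z∈′ | ∈-seqs⁻ k R∈
  ... | l , l∈ , refl | admR , lenR with ∈-compatParts⁻ l∈
  ... | lenl , adml = All.++⁺ admR (adml ∷ []) ,
                      trans (List.map-++ length R [ l ]) (trans (cong₂ (λ u v → u ++ [ v ]) lenR lenl) (sym (range-suc k)))

  ∈-seqs⁺ : ∀ k {R} → All Admissible R → map length R ≡ range k → R ∈ seqs n γ k
  ∈-seqs⁺ zero    {[]} _ _ = here refl
  ∈-seqs⁺ (suc k) {z} adm lens with map-++⁻ length z (trans lens (range-suc k))
  ... | R , l ∷ [] , refl , lenR , lenl =
    ∈-concatMap⁺ (λ R → map (λ l → R ++ [ l ]) (compatParts n γ (suc k)))
      (Any.map (λ { refl → ∈-map⁺ (λ l → R ++ [ l ]) (∈-compatParts⁺ (List.∷-injectiveˡ lenl) adml) })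
               (∈-seqs⁺ k (All.++⁻ˡ R adm) lenR))
    where
    adml : Admissible l
    adml with All.++⁻ʳ R adm
    ... | a ∷ [] = a

  Unique-seqs : ∀ k → Unique (seqs n γ k)
  Unique-seqs zero    = [] ∷ []
  Unique-seqs (suc k) = Unique-concatMap (Unique-seqs k)
    (λ {R} _ → Unique.map⁺ (List.∷ʳ-injectiveʳ R R) (Unique-compatParts (suc k))) samePrefix
    where
    samePrefix : ∀ {R R′ z} → R ∈ seqs n γ k → R′ ∈ seqs n γ k →
                 z ∈ map (λ l → R ++ [ l ]) (compatParts n γ (suc k)) →
                 z ∈ map (λ l → R′ ++ [ l ]) (compatParts n γ (suc k)) → R ≡ R′
    samePrefix {R} {R′} _ _ z∈ z∈′ with ∈-map⁻ (λ l → R ++ [ l ]) z∈ | ∈-map⁻ (λ l → R′ ++ [ l ]) z∈′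
    ... | _ , _ , refl | _ , _ , eq = List.∷ʳ-injectiveˡ R R′ eq

  Keyed : (List ℕ → ℕ) → (List ℕ → ℕ) → List (List ℕ) → Set
  Keyed k₁ k₂ L = All Admissible L × map k₁ L ≡ range m × map k₂ L ↭ range m

  ∈-tableaux⁻ : ∀ {R} → R ∈ tableaux n γ → Keyed length firstPart R
  ∈-tableaux⁻ R∈ with ∈-filter⁻ (λ R → T? (isPerm m (map firstPart R))) {xs = seqs n γ m} R∈
  ... | R∈′ , perm with ∈-seqs⁻ m R∈′
  ... | adm , lens = adm , lens , isPerm⁻ m _ perm

  ∈-tableaux⁺ : ∀ {R} → Keyed length firstPart R → R ∈ tableaux n γ
  ∈-tableaux⁺ (adm , lens , perm) =
    ∈-filter⁺ (λ R → T? (isPerm m (map firstPart R))) (∈-seqs⁺ m adm lens) (isPerm⁺ m _ perm)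

  Unique-tableaux : Unique (tableaux n γ)
  Unique-tableaux = Unique.filter⁺ (λ R → T? (isPerm m (map firstPart R))) (Unique-seqs m)

-- The transposed families: the expansion of det M(γ)

module Transposed (n : ℕ) (γ : Vec Bool n) where
  open Tableaux n γ

  keyed-sortBy : ∀ {k₁ k₂ L} → Keyed k₁ k₂ L → Keyed k₂ k₁ (sortBy m k₂ L)
  keyed-sortBy {k₁} {k₂} {L} (adm , keys₁ , keys↭) =
    All.tabulate (λ x∈ → All.lookup adm (∈-resp-↭ (sortBy-↭ keys↭) x∈)) ,
    sortBy-keys keys↭ ,
    ↭-trans (map⁺ k₁ (sortBy-↭ keys↭)) (↭-reflexive keys₁)

  sortBy-sortBy : ∀ {k₁ k₂ L} → Keyed k₁ k₂ L → sortBy m k₁ (sortBy m k₂ L) ≡ L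
  sortBy-sortBy {k₁} (_ , keys₁ , keys↭) = sortBy-reindex k₁ keys₁ (sortBy-↭ keys↭)

  F : ℕ → ℕ → List (List ℕ)
  F i j = filter (λ λ′ → T? (firstPart λ′ ≡ᵇ i)) (compatParts n γ j)

  Unique-F : ∀ i j → Unique (F i j)
  Unique-F i j = Unique.filter⁺ (λ λ′ → T? (firstPart λ′ ≡ᵇ i)) (Unique-compatParts j)

  choice⁻ : ∀ (h : ℕ → ℕ) ks {μ} → Pointwise _∈_ μ (map (λ i → F i (h i)) ks) →
            All Admissible μ × map firstPart μ ≡ ks × map length μ ≡ map h ks
  choice⁻ h []       []           = [] , refl , refl
  choice⁻ h (i ∷ ks) (x∈ ∷ μ∈)
    with ∈-filter⁻ (λ λ′ → T? (firstPart λ′ ≡ᵇ i)) {xs = compatParts n γ (h i)} x∈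
  ... | x∈′ , first with ∈-compatParts⁻ x∈′ | choice⁻ h ks μ∈
  ... | len , adm | adms , firsts , lens =
    adm ∷ adms , cong₂ _∷_ (≡ᵇ⇒≡ _ i first) firsts , cong₂ _∷_ len lens

  choice⁺ : ∀ (h : ℕ → ℕ) ks {μ} → All Admissible μ → map firstPart μ ≡ ks → map length μ ≡ map h ks →
            Pointwise _∈_ μ (map (λ i → F i (h i)) ks)
  choice⁺ h []       {[]}    _           _      _    = []
  choice⁺ h (i ∷ ks) {x ∷ μ} (adm ∷ adms) firsts lens =
    ∈-filter⁺ (λ λ′ → T? (firstPart λ′ ≡ᵇ i)) (∈-compatParts⁺ (List.∷-injectiveˡ lens) adm)
              (≡⇒≡ᵇ _ i (List.∷-injectiveˡ firsts))
    ∷ choice⁺ h ks adms (List.∷-injectiveʳ firsts) (List.∷-injectiveʳ lens)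

  -- The rows chosen for σ in the expansion of det M(γ): row i has first part i and length σ(i)
  choices : List ℕ → List (List (List ℕ))
  choices σ = cart (map (λ i → F i (part i σ)) (range m))

  transposed : List (List (List ℕ))
  transposed = concatMap choices (perms m)

  ∈-choices⁻ : ∀ {σ μ} → σ ∈ perms m → μ ∈ choices σ → Keyed firstPart length μ × map length μ ≡ σ
  ∈-choices⁻ {σ} {μ} σ∈ μ∈
    with choice⁻ (λ i → part i σ) (range m) (∈-cart⁻ (map (λ i → F i (part i σ)) (range m)) μ∈)
  ... | adm , firsts , lens = (adm , firsts , subst (_↭ range m) (sym lens≡σ) (∈-perms⁻ {m} σ∈)) , lens≡σ
    where
    lens≡σ : map length μ ≡ σ
    lens≡σ = trans lens (parts-of-↭ (∈-perms⁻ {m} σ∈))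

  ∈-transposed⁻ : ∀ {μ} → μ ∈ transposed → Keyed firstPart length μ
  ∈-transposed⁻ μ∈ with find (∈-concatMap⁻ choices {xs = perms m} μ∈)
  ... | σ , σ∈ , μ∈′ = proj₁ (∈-choices⁻ σ∈ μ∈′)

  ∈-transposed⁺ : ∀ {μ} → Keyed firstPart length μ → μ ∈ transposed
  ∈-transposed⁺ {μ} (adm , firsts , lens↭) =
    ∈-concatMap⁺ choices (Any.map (λ { refl → μ∈ }) (∈-perms⁺ {m} lens↭))
    where
    σ = map length μ
    μ∈ : μ ∈ choices σ
    μ∈ = ∈-cart⁺ (map (λ i → F i (part i σ)) (range m))
                 (choice⁺ (λ i → part i σ) (range m) adm firsts (sym (parts-of-↭ lens↭)))

  Unique-transposed : Unique transposed
  Unique-transposed = Unique-concatMap (Unique-perms m)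
    (λ {σ} _ → Unique-cart (map (λ i → F i (part i σ)) (range m))
                           (All.map⁺ (All.tabulate {xs = range m} (λ {i} _ → Unique-F i (part i σ)))))
    (λ σ∈ σ′∈ μ∈ μ∈′ → trans (sym (proj₂ (∈-choices⁻ σ∈ μ∈))) (proj₂ (∈-choices⁻ σ′∈ μ∈′)))

  tableaux↭transposed : tableaux n γ ↭ map (sortBy m length) transposed
  tableaux↭transposed = unique-↭ Unique-tableaux (Unique-map injective Unique-transposed) to from
    where
    injective : ∀ {μ ν} → μ ∈ transposed → ν ∈ transposed → sortBy m length μ ≡ sortBy m length ν → μ ≡ ν
    injective μ∈ ν∈ eq = trans (sym (sortBy-sortBy (∈-transposed⁻ μ∈)))
                               (trans (cong (sortBy m firstPart) eq) (sortBy-sortBy (∈-transposed⁻ ν∈)))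
    to : ∀ {R} → R ∈ tableaux n γ → R ∈ map (sortBy m length) transposed
    to R∈ = subst (_∈ map (sortBy m length) transposed) (sortBy-sortBy (∈-tableaux⁻ R∈))
                  (∈-map⁺ (sortBy m length) (∈-transposed⁺ (keyed-sortBy (∈-tableaux⁻ R∈))))
    from : ∀ {R} → R ∈ map (sortBy m length) transposed → R ∈ tableaux n γ
    from R∈ with ∈-map⁻ (sortBy m length) R∈
    ... | μ , μ∈ , refl = ∈-tableaux⁺ (keyed-sortBy (∈-transposed⁻ μ∈))

-- The j-th parts of the rows j, j+1, … of R (the rows before j are too short)
column : ℕ → List (List ℕ) → List ℕ
column j R = map (part j) (drop (j ∸ 1) R)

splice : ℕ → List ℕ → List ℕ → List ℕ
splice k u v = take k u ++ drop k v

rowAt : ℕ → List (List ℕ) → List ℕ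
rowAt i       []      = []
rowAt zero    (X ∷ R) = X
rowAt (suc i) (X ∷ R) = rowAt i R

replaceAt : ℕ → List ℕ → List (List ℕ) → List (List ℕ)
replaceAt i       V []      = []
replaceAt zero    V (X ∷ R) = V ∷ R
replaceAt (suc i) V (X ∷ R) = X ∷ replaceAt i V R

-- Exchange the first k parts of the rows at positions i and i + 1 + d
exchangeRows : ℕ → ℕ → ℕ → List (List ℕ) → List (List ℕ)
exchangeRows k i       d []      = []
exchangeRows k (suc i) d (Z ∷ R) = Z ∷ exchangeRows k i d R
exchangeRows k zero    d (X ∷ R) = splice k (rowAt d R) X ∷ replaceAt d (splice k X (rowAt d R)) R

rowAt-prefix : ∀ (B : List (List ℕ)) Y C → rowAt (length B) (B ++ Y ∷ C) ≡ Y
rowAt-prefix []      Y C = refl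
rowAt-prefix (_ ∷ B) Y C = rowAt-prefix B Y C

replaceAt-prefix : ∀ (B : List (List ℕ)) V Y C → replaceAt (length B) V (B ++ Y ∷ C) ≡ B ++ V ∷ C
replaceAt-prefix []      V Y C = refl
replaceAt-prefix (Z ∷ B) V Y C = cong (Z ∷_) (replaceAt-prefix B V Y C)

exchangeRows-two : ∀ k (A B C : List (List ℕ)) X Y →
  exchangeRows k (length A) (length B) (A ++ X ∷ B ++ Y ∷ C) ≡ A ++ splice k Y X ∷ B ++ splice k X Y ∷ C
exchangeRows-two k (Z ∷ A) B C X Y = cong (Z ∷_) (exchangeRows-two k A B C X Y)
exchangeRows-two k []      B C X Y rewrite rowAt-prefix B Y C =
  cong (splice k Y X ∷_) (replaceAt-prefix B (splice k X Y) Y C)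

splice-common : ∀ k (p q : List ℕ) c s t → length p ≡ k → length q ≡ k →
                splice k (q ++ c ∷ t) (p ++ c ∷ s) ≡ q ++ c ∷ s
splice-common k p q c s t |p| |q| = cong₂ _++_
  (trans (cong (λ i → take i (q ++ c ∷ t)) (sym |q|)) (take-prefix q (c ∷ t)))
  (trans (cong (λ i → drop i (p ++ c ∷ s)) (sym |p|)) (drop-prefix p (c ∷ s)))

firstPart-drop : ∀ i (q : List ℕ) c s t → i ≤ length q →
                 firstPart (drop i (q ++ c ∷ s)) ≡ firstPart (drop i (q ++ c ∷ t))
firstPart-drop zero    []      c s t _         = refl
firstPart-drop zero    (x ∷ q) c s t _         = refl
firstPart-drop (suc i) (x ∷ q) c s t (s≤s i≤q) = firstPart-drop i q c s t i≤q

part-at : ∀ j (p : List ℕ) c s → length p ≡ j → part (suc j) (p ++ c ∷ s) ≡ c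
part-at j p c s refl = cong firstPart (drop-prefix p (c ∷ s))

module Involution (m : ℕ) where

  badColumn : List (List ℕ) → Maybe ℕ
  badColumn R = findᵇ (λ j → not (distinct (column j R))) (range m)

  resolveAt : List (List ℕ) → ℕ → Maybe (ℕ × ℕ) → List (List ℕ)
  resolveAt R j nothing        = R
  resolveAt R j (just (a , d)) = exchangeRows (j ∸ 1) ((j ∸ 1) + a) d R

  resolve : List (List ℕ) → Maybe ℕ → List (List ℕ)
  resolve R nothing  = R
  resolve R (just j) = resolveAt R j (firstRepeat (column j R))

  ι : List (List ℕ) → List (List ℕ)
  ι R = resolve R (badColumn R)

  record Collision (R : List (List ℕ)) : Set where
    constructor collision
    field
      j a d c : ℕ
      U V W   : List (List ℕ)
      p q s t : List ℕ
      shape   : R ≡ U ++ (p ++ c ∷ s) ∷ V ++ (q ++ c ∷ t) ∷ W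
      |p|     : length p ≡ j
      |q|     : length q ≡ j
      bad     : badColumn R ≡ just (suc j)
      repeat  : firstRepeat (column (suc j) R) ≡ just (a , d)
      |U|     : j + a ≡ length U
      |V|     : d ≡ length V

    swapped : List (List ℕ)
    swapped = U ++ (q ++ c ∷ s) ∷ V ++ (p ++ c ∷ t) ∷ W

  open Collision public using (swapped)

  ι-collision : ∀ {R} (S : Collision R) → ι R ≡ swapped S
  ι-collision (collision j a d c U V W p q s t refl |p| |q| bad repeat |U| |V|)
    rewrite bad | repeat | |U| | |V| =
    trans (exchangeRows-two j U V W _ _)
          (cong₂ (λ X Y → U ++ X ∷ V ++ Y ∷ W) (splice-common j p q c s t |p| |q|) (splice-common j q p c t s |q| |p|))

  column-swapped : ∀ {R} (S : Collision R) k → k ≤ suc (Collision.j S) →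
    let open Collision S hiding (swapped) in
    column k R ≡ map (part k) (drop (k ∸ 1) U) ++ part k (p ++ c ∷ s) ∷ map (part k) V
                   ++ part k (q ++ c ∷ t) ∷ map (part k) W ×
    column k (swapped S) ≡ map (part k) (drop (k ∸ 1) U) ++ part k (q ++ c ∷ t) ∷ map (part k) V
                             ++ part k (p ++ c ∷ s) ∷ map (part k) W
  column-swapped (collision j a d c U V W p q s t refl |p| |q| _ _ |U| _) k k≤ =
    columns (p ++ c ∷ s) (q ++ c ∷ t) ,
    trans (columns (q ++ c ∷ s) (p ++ c ∷ t))
          (cong₂ (λ X Y → map (part k) (drop (k ∸ 1) U) ++ X ∷ map (part k) V ++ Y ∷ map (part k) W)
                 (firstPart-drop (k ∸ 1) q c s t (at-most q |q|)) (firstPart-drop (k ∸ 1) p c t s (at-most p |p|)))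
    where
    k∸1≤j : k ∸ 1 ≤ j
    k∸1≤j = ℕₚ.∸-monoˡ-≤ 1 k≤
    j≤U : j ≤ length U
    j≤U = subst (j ≤_) |U| (ℕₚ.m≤m+n j a)
    at-most : ∀ (u : List ℕ) → length u ≡ j → k ∸ 1 ≤ length u
    at-most u refl = k∸1≤j
    columns : ∀ X Y → column k (U ++ X ∷ V ++ Y ∷ W) ≡
              map (part k) (drop (k ∸ 1) U) ++ part k X ∷ map (part k) V ++ part k Y ∷ map (part k) W
    columns X Y = trans (cong (map (part k)) (drop-++-≤ (k ∸ 1) U _ (ℕₚ.≤-trans k∸1≤j j≤U)))
                        (map-two (part k) (drop (k ∸ 1) U) V W X Y)

  column-swapped-↭ : ∀ {R} (S : Collision R) k → k ≤ suc (Collision.j S) → column k (swapped S) ↭ column k R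
  column-swapped-↭ S k k≤ with column-swapped S k k≤
  ... | col , col′ rewrite col | col′ = exchange-↭ _ _ _ _ _

  -- The colliding column is unchanged, since both colliding entries are c
  column-swapped-≡ : ∀ {R} (S : Collision R) → column (suc (Collision.j S)) (swapped S) ≡ column (suc (Collision.j S)) R
  column-swapped-≡ S@(collision j a d c U V W p q s t refl |p| |q| _ _ _ _) =
    trans (proj₂ columns) (trans (cong₂ (λ x y → P ++ x ∷ Q ++ y ∷ Q′) (trans cY (sym cX)) (trans cX (sym cY)))
                                 (sym (proj₁ columns)))
    where
    columns = column-swapped S (suc j) ≤-refl
    P = map (part (suc j)) (drop j U)
    Q = map (part (suc j)) V
    Q′ = map (part (suc j)) W
    cX = part-at j p c s |p|
    cY = part-at j q c t |q|

  collision-swapped : ∀ {R} (S : Collision R) → Collision (swapped S)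
  collision-swapped {R} S@(collision j a d c U V W p q s t refl |p| |q| bad repeat |U| |V|) =
    collision j a d c U V W q p s t refl |q| |p| bad′ (trans (cong firstRepeat (column-swapped-≡ S)) repeat) |U| |V|
    where
    bad′ : badColumn (swapped S) ≡ just (suc j)
    bad′ = findᵇ-stable _ _ (range m) (range-increasing m) bad
             (λ {k} _ k≤ → cong not (distinct-↭ (column-swapped-↭ S k k≤)))

  swapped-swapped : ∀ {R} (S : Collision R) → swapped (collision-swapped S) ≡ R
  swapped-swapped (collision j a d c U V W p q s t refl _ _ _ _ _ _) = refl

  swapped-≢ : ∀ {R} → Unique (map firstPart R) → (S : Collision R) → swapped S ≢ R
  swapped-≢ uniq (collision j a d c U V W p q s t refl |p| |q| _ _ _ _) eq =
    proj₁ (two-distinct (map firstPart U) (map firstPart V) (map firstPart W)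
                        (subst Unique (map-two firstPart U V W _ _) uniq))
          (trans (sym (cong firstPart X≡)) (firstPart-drop 0 q c s t z≤n))
    where
    X≡ : q ++ c ∷ s ≡ p ++ c ∷ s
    X≡ = List.∷-injectiveˡ (List.++-cancelˡ U _ _ eq)

  -- a row at position i of a family whose row lengths are 1, …, m has i + 1 parts,
  -- so it splits after its first j parts when j ≤ i
  row-split : ∀ j P {X Z} → map length (P ++ X ∷ Z) ≡ range m → j ≤ length P →
              ∃₂ λ (p : List ℕ) c′ → ∃ λ s → X ≡ p ++ c′ ∷ s × length p ≡ j
  row-split j P lens j≤ = split-at j _ (subst (j <_) (sym (key-at length suc P lens)) (s≤s j≤))

  collision-rows : ∀ {R} j a d c U X V Y W → map length R ≡ range m → R ≡ U ++ X ∷ V ++ Y ∷ W →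
    part (suc j) X ≡ c → part (suc j) Y ≡ c → badColumn R ≡ just (suc j) →
    firstRepeat (column (suc j) R) ≡ just (a , d) → j + a ≡ length U → d ≡ length V → Collision R
  collision-rows j a d c U X V Y W lens refl cX cY bad repeat |U| |V|
    with row-split j U lens (subst (j ≤_) |U| (ℕₚ.m≤m+n j a))
       | row-split j (U ++ X ∷ V) (subst (λ R → map length R ≡ range m) (sym (List.++-assoc U (X ∷ V) (Y ∷ W))) lens)
                   (ℕₚ.≤-trans (subst (j ≤_) |U| (ℕₚ.m≤m+n j a)) (List.length-++-≤ˡ U))
  ... | p , c₁ , s , refl , |p| | q , c₂ , t , refl , |q|
    with trans (sym (part-at j p c₁ s |p|)) cX | trans (sym (part-at j q c₂ t |q|)) cY
  ... | refl | refl = collision j a d c U V W p q s t refl |p| |q| bad repeat |U| |V|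

  collision-at : ∀ {R} J → 1 ≤ J → J ≤ m → map length R ≡ range m → badColumn R ≡ just J →
                 ¬ T (distinct (column J R)) → Collision R
  collision-at {R} (suc j) (s≤s z≤n) J≤m lens bad ¬distinct
    with firstRepeat-exists (column (suc j) R) ¬distinct
  ... | (a , d) , repeat with firstRepeat-spec (column (suc j) R) repeat
  ... | V₁ , c , V₂ , V₃ , col≡ , |V₁| , |V₂| with map-two⁻ (part (suc j)) (drop j R) col≡
  ... | Z₁ , X , Y , V , W , drop≡ , eq₁ , cX , eqV , cY =
    collision-rows j a d c (take j R ++ Z₁) X V Y W lens R≡ cX cY bad repeat (sym |U|) |V|
    where
    R≡ : R ≡ (take j R ++ Z₁) ++ X ∷ V ++ Y ∷ W
    R≡ = trans (sym (List.take++drop≡id j R)) (trans (cong (take j R ++_) drop≡) (sym (List.++-assoc (take j R) Z₁ _)))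
    |R| : length R ≡ m
    |R| = trans (sym (List.length-map length R)) (trans (cong length lens) (length-range m))
    |take| : length (take j R) ≡ j
    |take| = trans (List.length-take j R)
                   (ℕₚ.m≤n⇒m⊓n≡m (ℕₚ.≤-trans (ℕₚ.n≤1+n j) (subst (suc j ≤_) (sym |R|) J≤m)))
    |U| : length (take j R ++ Z₁) ≡ j + a
    |U| = trans (List.length-++ (take j R))
                (cong₂ _+_ |take| (trans (sym (List.length-map (part (suc j)) Z₁)) (trans (cong length eq₁) |V₁|)))
    |V| : d ≡ length V
    |V| = trans (sym |V₂|) (trans (cong length (sym eqV)) (List.length-map (part (suc j)) V))

  collision-of : ∀ {R} → map length R ≡ range m → ¬ T (nonIntersecting m R) → Collision R
  collision-of {R} lens ¬ni with findᵇ-violation (λ J → distinct (column J R)) (range m) ¬ni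
  ... | J , bad with findᵇ-just (λ J → not (distinct (column J R))) (range m) bad
  ... | J∈ , ¬distinct = collision-at J (proj₁ (∈-range⁻ J∈)) (proj₂ (∈-range⁻ J∈)) lens bad (T-not⁻ ¬distinct)

  collision-bad : ∀ {R} → Collision R → ¬ T (nonIntersecting m R)
  collision-bad {R} S = findᵇ-violation⁻ (λ J → distinct (column J R)) (range m) (Collision.bad S)

module TableauExchange (n : ℕ) (γ : Vec Bool n) where
  open Tableaux n γ
  open Involution m

  positive : ∀ {λ′} → All (_∈ range m) λ′ → All (1 ≤_) λ′
  positive = All.map (λ x∈ → proj₁ (∈-range⁻ x∈))

  admissible-splice : ∀ (p q : List ℕ) c s t → length p ≡ length q →
                      Admissible (p ++ c ∷ s) → Admissible (q ++ c ∷ t) → Admissible (q ++ c ∷ s)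
  admissible-splice p q c s t |p|≡|q| (boundedX , compatX) (boundedY , compatY) =
    bounded , compatible-splice (toList γ) p q c s t |p|≡|q| (positive boundedX) (positive boundedY) (positive bounded) compatX compatY
    where
    bounded : All (_∈ range m) (q ++ c ∷ s)
    bounded = All.++⁺ (All.++⁻ˡ q boundedY) (All.++⁻ʳ p boundedX)

  keyed-swapped : ∀ {R} → Keyed length firstPart R → (S : Collision R) → Keyed length firstPart (swapped S)
  keyed-swapped (adm , lens , firsts) (collision j a d c U V W p q s t refl |p| |q| _ _ _ _)
    with All-two⁻ U V W adm
  ... | admU , admX , admV , admY , admW =
    All-two⁺ U V W admU (admissible-splice p q c s t |p|≡|q| admX admY) admV
                        (admissible-splice q p c t s (sym |p|≡|q|) admY admX) admW ,
    trans lengths′ lens ,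
    ↭-trans firsts′ firsts
    where
    X = p ++ c ∷ s
    Y = q ++ c ∷ t
    |p|≡|q| : length p ≡ length q
    |p|≡|q| = trans |p| (sym |q|)
    same-length : ∀ (u v : List ℕ) r → length v ≡ length u → length (u ++ c ∷ r) ≡ length (v ++ c ∷ r)
    same-length u v r eq = trans (List.length-++ u) (trans (cong (_+ length (c ∷ r)) (sym eq)) (sym (List.length-++ v)))
    lengths′ : map length (U ++ (q ++ c ∷ s) ∷ V ++ (p ++ c ∷ t) ∷ W) ≡ map length (U ++ X ∷ V ++ Y ∷ W)
    lengths′ = trans (map-two length U V W _ _)
      (trans (cong₂ (λ x y → map length U ++ x ∷ map length V ++ y ∷ map length W)
                    (same-length q p s |p|≡|q|) (same-length p q t (sym |p|≡|q|)))
             (sym (map-two length U V W X Y)))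
    firsts′ : map firstPart (U ++ (q ++ c ∷ s) ∷ V ++ (p ++ c ∷ t) ∷ W) ↭ map firstPart (U ++ X ∷ V ++ Y ∷ W)
    firsts′ = begin
      map firstPart (U ++ (q ++ c ∷ s) ∷ V ++ (p ++ c ∷ t) ∷ W)
        ≡⟨ map-two firstPart U V W _ _ ⟩
      map firstPart U ++ firstPart (q ++ c ∷ s) ∷ map firstPart V ++ firstPart (p ++ c ∷ t) ∷ map firstPart W
        ≡⟨ cong₂ (λ x y → map firstPart U ++ x ∷ map firstPart V ++ y ∷ map firstPart W)
                 (firstPart-drop 0 q c s t z≤n) (firstPart-drop 0 p c t s z≤n) ⟩
      map firstPart U ++ firstPart Y ∷ map firstPart V ++ firstPart X ∷ map firstPart W
        ↭⟨ exchange-↭ _ _ _ _ _ ⟩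
      map firstPart U ++ firstPart X ∷ map firstPart V ++ firstPart Y ∷ map firstPart W
        ≡⟨ sym (map-two firstPart U V W X Y) ⟩
      map firstPart (U ++ X ∷ V ++ Y ∷ W) ∎
      where open PermutationReasoning

module RingSums {c ℓ : Level} (ℛ : CommutativeRing c ℓ) where
  open CommutativeRing ℛ renaming (_+_ to _+ᴿ_; refl to ≈-refl; sym to ≈-sym; trans to ≈-trans)
  open WithRing ℛ using (sumR; prodR)
  open import Relation.Binary.Reasoning.Setoid setoid

  sum-++ : ∀ xs ys → sumR (xs ++ ys) ≈ sumR xs +ᴿ sumR ys
  sum-++ []       ys = ≈-sym (+-identityˡ _)
  sum-++ (x ∷ xs) ys = ≈-trans (+-congˡ (sum-++ xs ys)) (≈-sym (+-assoc _ _ _))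

  sum-cong : ∀ {f g : A → Carrier} xs → (∀ {x} → x ∈ xs → f x ≈ g x) → sumR (map f xs) ≈ sumR (map g xs)
  sum-cong []       _   = ≈-refl
  sum-cong (x ∷ xs) f≈g = +-cong (f≈g (here refl)) (sum-cong xs (f≈g ∘ there))

  sum-map : ∀ (f : B → Carrier) (g : A → B) xs → sumR (map f (map g xs)) ≡ sumR (map (f ∘ g) xs)
  sum-map f g xs = cong sumR (sym (List.map-∘ xs))

  sum-concatMap : ∀ (f : B → Carrier) (g : A → List B) xs →
                  sumR (map f (concatMap g xs)) ≈ sumR (map (λ x → sumR (map f (g x))) xs)
  sum-concatMap f g []       = ≈-refl
  sum-concatMap f g (x ∷ xs) = begin
    sumR (map f (g x ++ concatMap g xs))                ≡⟨ cong sumR (List.map-++ f (g x) _) ⟩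
    sumR (map f (g x) ++ map f (concatMap g xs))       ≈⟨ sum-++ (map f (g x)) _ ⟩
    sumR (map f (g x)) +ᴿ sumR (map f (concatMap g xs)) ≈⟨ +-congˡ (sum-concatMap f g xs) ⟩
    sumR (map f (g x)) +ᴿ sumR (map (λ x → sumR (map f (g x))) xs) ∎

  sum-↭ : ∀ (f : A → Carrier) {xs ys} → xs ↭ ys → sumR (map f xs) ≈ sumR (map f ys)
  sum-↭ f p = SetoidPerm.foldr-commMonoid setoid +-isCommutativeMonoid (↭⇒↭ₛ′ isEquivalence (map⁺ f p))

  prod-↭ : ∀ (f : A → Carrier) {xs ys} → xs ↭ ys → prodR (map f xs) ≈ prodR (map f ys)
  prod-↭ f p = SetoidPerm.foldr-commMonoid setoid *-isCommutativeMonoid (↭⇒↭ₛ′ isEquivalence (map⁺ f p))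

  sum-filter : ∀ {p} {P : Pred A p} (P? : Decidable P) (f : A → Carrier) xs →
               sumR (map f xs) ≈ sumR (map f (filter P? xs)) +ᴿ sumR (map f (filter (¬? ∘ P?) xs))
  sum-filter P? f []       = ≈-sym (+-identityˡ _)
  sum-filter P? f (x ∷ xs) with P? x
  ... | yes _ = ≈-trans (+-congˡ (sum-filter P? f xs)) (≈-sym (+-assoc _ _ _))
  ... | no  _ = begin
    f x +ᴿ sumR (map f xs)   ≈⟨ +-congˡ (sum-filter P? f xs) ⟩
    f x +ᴿ (S₁ +ᴿ S₂)        ≈⟨ ≈-sym (+-assoc _ _ _) ⟩
    (f x +ᴿ S₁) +ᴿ S₂        ≈⟨ +-congʳ (+-comm _ _) ⟩
    (S₁ +ᴿ f x) +ᴿ S₂        ≈⟨ +-assoc _ _ _ ⟩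
    S₁ +ᴿ (f x +ᴿ S₂)        ∎
    where
    S₁ = sumR (map f (filter P? xs))
    S₂ = sumR (map f (filter (¬? ∘ P?) xs))

  sum-scale : ∀ (k : Carrier) (f : A → Carrier) xs → k * sumR (map f xs) ≈ sumR (map (λ x → k * f x) xs)
  sum-scale k f []       = zeroʳ k
  sum-scale k f (x ∷ xs) = ≈-trans (distribˡ _ _ _) (+-congˡ (sum-scale k f xs))

  prod-sum : ∀ (w : A → Carrier) (Fs : List (List A)) →
             prodR (map (λ F → sumR (map w F)) Fs) ≈ sumR (map (λ μ → prodR (map w μ)) (cart Fs))
  prod-sum w []       = ≈-sym (+-identityʳ _)
  prod-sum w (F ∷ Fs) = begin
    sumR (map w F) * prodR (map (λ F → sumR (map w F)) Fs) ≈⟨ *-congˡ (prod-sum w Fs) ⟩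
    sumR (map w F) * S                                      ≈⟨ *-comm _ _ ⟩
    S * sumR (map w F)                                      ≈⟨ sum-scale S w F ⟩
    sumR (map (λ x → S * w x) F)                            ≈⟨ sum-cong F (λ {x} _ → row x) ⟩
    sumR (map (λ x → sumR (map Π (map (x ∷_) (cart Fs)))) F) ≈⟨ ≈-sym (sum-concatMap Π _ F) ⟩
    sumR (map Π (cart (F ∷ Fs)))                            ∎
    where
    Π = λ μ → prodR (map w μ)
    S = sumR (map Π (cart Fs))
    row : ∀ x → S * w x ≈ sumR (map Π (map (x ∷_) (cart Fs)))
    row x = begin
      S * w x                                  ≈⟨ *-comm _ _ ⟩
      w x * S                                  ≈⟨ sum-scale (w x) Π (cart Fs) ⟩
      sumR (map (λ μ → w x * Π μ) (cart Fs))   ≡⟨ sym (sum-map Π (x ∷_) (cart Fs)) ⟩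
      sumR (map Π (map (x ∷_) (cart Fs)))      ∎

  record SignReversingInvolution {a} {A : Set a} (f : A → Carrier) (xs : List A) : Set (a ⊔ c ⊔ ℓ) where
    field
      ι           : A → A
      closed      : ∀ {x} → x ∈ xs → ι x ∈ xs
      involutive  : ∀ {x} → x ∈ xs → ι (ι x) ≡ x
      no-fixpoint : ∀ {x} → x ∈ xs → ι x ≢ x
      reverses    : ∀ {x} → x ∈ xs → f (ι x) ≈ - f x

  involution-sum : ∀ (f : A → Carrier) xs → Unique xs → SignReversingInvolution f xs → sumR (map f xs) ≈ 0#
  involution-sum f xs u I = cancel (length xs) xs ℕₚ.≤-refl u I
    where
    cancel : ∀ k xs → length xs ≤ k → Unique xs → SignReversingInvolution f xs → sumR (map f xs) ≈ 0#
    cancel _       []       _   _ _ = ≈-refl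
    cancel zero    (_ ∷ _)  ()
    cancel (suc k) (x ∷ xs) (s≤s len) u I with SignReversingInvolution.closed I (here refl)
    ... | here ιx≡x = ⊥-elim (SignReversingInvolution.no-fixpoint I (here refl) ιx≡x)
    ... | there ιx∈xs with ∈⇒↭ ιx∈xs
    ... | ys , xs↭ = begin
      sumR (map f (x ∷ xs))             ≈⟨ sum-↭ f x∷xs↭ ⟩
      f x +ᴿ (f (ι x) +ᴿ sumR (map f ys)) ≈⟨ ≈-sym (+-assoc _ _ _) ⟩
      (f x +ᴿ f (ι x)) +ᴿ sumR (map f ys) ≈⟨ +-cong pair-cancels (cancel k ys len′ uys I′) ⟩
      0# +ᴿ 0#                          ≈⟨ +-identityˡ 0# ⟩
      0#                                ∎
      where
      open SignReversingInvolution I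
      x∷xs↭ : x ∷ xs ↭ x ∷ ι x ∷ ys
      x∷xs↭ = ↭-prep x xs↭
      len′ : length ys ≤ k
      len′ = ℕₚ.≤-trans (ℕₚ.n≤1+n _) (ℕₚ.≤-trans (ℕₚ.≤-reflexive (sym (↭-length xs↭))) len)
      uys′ : Unique (x ∷ ι x ∷ ys)
      uys′ = Unique-resp-↭ x∷xs↭ u
      uys : Unique ys
      uys with uys′
      ... | _ ∷ _ ∷ u′ = u′
      from-ys : ∀ {y} → y ∈ ys → y ∈ x ∷ xs
      from-ys y∈ys = ∈-resp-↭ (↭-sym x∷xs↭) (there (there y∈ys))
      pair-cancels : f x +ᴿ f (ι x) ≈ 0#
      pair-cancels = ≈-trans (+-congˡ (reverses (here refl))) (-‿inverseʳ (f x))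
      closed′ : ∀ {y} → y ∈ ys → ι y ∈ ys
      closed′ {y} y∈ys with uys′ | ∈-resp-↭ x∷xs↭ (closed (from-ys y∈ys))
      ... | x∉ ∷ ιx∉ ∷ _ | here ιy≡x =
        ⊥-elim (All.lookup ιx∉ y∈ys (trans (cong ι (sym ιy≡x)) (involutive (from-ys y∈ys))))
      ... | x∉ ∷ ιx∉ ∷ _ | there (here ιy≡ιx) =
        ⊥-elim (All.lookup (All.tail x∉) y∈ys
                  (trans (sym (involutive (here refl))) (trans (cong ι (sym ιy≡ιx)) (involutive (from-ys y∈ys)))))
      ... | _ | there (there ιy∈ys) = ιy∈ys
      I′ : SignReversingInvolution f ys
      I′ = record { ι = ι ; closed = closed′ ; involutive = involutive ∘ from-ys
                  ; no-fixpoint = no-fixpoint ∘ from-ys ; reverses = reverses ∘ from-ys }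

module Signs {c ℓ : Level} (ℛ : CommutativeRing c ℓ) where
  open CommutativeRing ℛ using (Carrier; _≈_; 1#; -_; +-abelianGroup) renaming (refl to ≈-refl; sym to ≈-sym)
  open WithRing ℛ using (sgn)
  open import Algebra.Properties.AbelianGroup +-abelianGroup using (⁻¹-involutive)

  sgn-cong : ∀ σ τ → inversions σ ≡ inversions τ → sgn σ ≡ sgn τ
  sgn-cong σ τ eq = cong (λ k → if isEven k then 1# else - 1#) eq

  sgn-transpose : ∀ P Q S {u v} → Unique (P ++ u ∷ Q ++ v ∷ S) →
                  sgn (P ++ v ∷ Q ++ u ∷ S) ≈ - sgn (P ++ u ∷ Q ++ v ∷ S)
  sgn-transpose P Q S {u} {v} uniq with two-distinct P Q S uniq
  ... | u≢v , u≢Q , Q≢v with isEven (inversions (P ++ u ∷ Q ++ v ∷ S)) | inversions-transpose P Q S u≢v u≢Q Q≢v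
  ... | true  | opposite rewrite opposite = ≈-refl
  ... | false | opposite rewrite opposite = ≈-sym (⁻¹-involutive 1#)

-- Σpi(γ) = det M(γ): both are the signed sum over the transposed families

module Determinant {c ℓ : Level} (ℛ : CommutativeRing c ℓ) (n : ℕ) (γ : Vec Bool n)
                   (a b : ℕ → CommutativeRing.Carrier ℛ) where
  open CommutativeRing ℛ renaming (_+_ to _+ᴿ_; refl to ≈-refl; sym to ≈-sym; trans to ≈-trans)
  open WithRing ℛ
  open RingSums ℛ
  open Signs ℛ
  open Tableaux n γ
  open Transposed n γ
  open import Relation.Binary.Reasoning.Setoid setoid

  w : List ℕ → Carrier
  w = weight a b

  transposedWeight : List (List ℕ) → Carrier
  transposedWeight μ = sgn (map length μ) * prodR (map w μ)

  -- Σpi(γ) is the signed sum over the transposed families: each tableau is the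
  -- re-listing by length of a transposed family with the same signed weight.
  Σpi≈transposed : Σpi n γ a b ≈ sumR (map transposedWeight transposed)
  Σpi≈transposed = begin
    sumR (map (tabWeight a b) (tableaux n γ))                    ≈⟨ sum-↭ (tabWeight a b) tableaux↭transposed ⟩
    sumR (map (tabWeight a b) (map (sortBy m length) transposed)) ≡⟨ sum-map (tabWeight a b) (sortBy m length) transposed ⟩
    sumR (map (tabWeight a b ∘ sortBy m length) transposed)       ≈⟨ sum-cong transposed (relisted ∘ ∈-transposed⁻) ⟩
    sumR (map transposedWeight transposed)                        ∎
    where
    relisted : ∀ {μ} → Keyed firstPart length μ → tabWeight a b (sortBy m length μ) ≈ transposedWeight μ
    relisted {μ} (_ , firsts , lens↭) =
      *-cong (reflexive (sgn-cong (map firstPart (sortBy m length μ)) (map length μ)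
                                  (sortBy-inversions firstPart length firsts lens↭)))
             (prod-↭ w (sortBy-↭ lens↭))

  -- So is det M(γ): expand each product of entries P_{i,σ(i)} by distributivity.
  det≈transposed : det m (M n γ a b) ≈ sumR (map transposedWeight transposed)
  det≈transposed = begin
    sumR (map (λ σ → sgn σ * prodR (map (λ i → M n γ a b i (part i σ)) (range m))) (perms m))
      ≈⟨ sum-cong (perms m) expand ⟩
    sumR (map (λ σ → sumR (map transposedWeight (choices σ))) (perms m))
      ≈⟨ ≈-sym (sum-concatMap transposedWeight choices (perms m)) ⟩
    sumR (map transposedWeight transposed) ∎
    where
    expand : ∀ {σ} → σ ∈ perms m →
             sgn σ * prodR (map (λ i → M n γ a b i (part i σ)) (range m)) ≈ sumR (map transposedWeight (choices σ))
    expand {σ} σ∈ = begin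
      sgn σ * prodR (map (λ i → M n γ a b i (part i σ)) (range m))
        ≡⟨ cong (λ Ms → sgn σ * prodR Ms) (List.map-∘ (range m)) ⟩
      sgn σ * prodR (map (λ G → sumR (map w G)) (map (λ i → F i (part i σ)) (range m)))
        ≈⟨ *-congˡ (prod-sum w (map (λ i → F i (part i σ)) (range m))) ⟩
      sgn σ * sumR (map (λ μ → prodR (map w μ)) (choices σ))
        ≈⟨ sum-scale (sgn σ) (λ μ → prodR (map w μ)) (choices σ) ⟩
      sumR (map (λ μ → sgn σ * prodR (map w μ)) (choices σ))
        ≈⟨ sum-cong (choices σ) (λ μ∈ → *-congʳ (reflexive (cong sgn (sym (proj₂ (∈-choices⁻ σ∈ μ∈)))))) ⟩
      sumR (map transposedWeight (choices σ)) ∎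

  Σpi≈det : Σpi n γ a b ≈ det m (M n γ a b)
  Σpi≈det = ≈-trans Σpi≈transposed (≈-sym det≈transposed)

-- Σni(γ) = Σpi(γ): the exchange involution cancels the intersecting tableaux

module Cancellation {c ℓ : Level} (ℛ : CommutativeRing c ℓ) (n : ℕ) (γ : Vec Bool n)
                    (a b : ℕ → CommutativeRing.Carrier ℛ) where
  open CommutativeRing ℛ renaming (_+_ to _+ᴿ_; refl to ≈-refl; sym to ≈-sym; trans to ≈-trans)
  open WithRing ℛ
  open RingSums ℛ
  open Signs ℛ
  open Tableaux n γ
  open Involution m
  open TableauExchange n γ
  open import Relation.Binary.Reasoning.Setoid setoid
  open import Algebra.Properties.Ring ring using (-‿distribˡ-*)
  open import Algebra.Properties.CommutativeSemigroup *-commutativeSemigroup using (interchange)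

  w : List ℕ → Carrier
  w = weight a b

  weightGo-split : ∀ k (u : List ℕ) c v →
                   weightGo a b k (u ++ c ∷ v) ≈ weightGo a b k (u ++ [ c ]) * weightGo a b (k + length u) (c ∷ v)
  weightGo-split k []          c v rewrite ℕₚ.+-identityʳ k = ≈-sym (*-identityˡ _)
  weightGo-split k (x ∷ [])    c v rewrite ℕₚ.+-comm k 1 = *-congʳ (≈-sym (*-identityʳ _))
  weightGo-split k (x ∷ y ∷ u) c v = begin
    f * weightGo a b (suc k) (y ∷ u ++ c ∷ v)
      ≈⟨ *-congˡ (weightGo-split (suc k) (y ∷ u) c v) ⟩
    f * (weightGo a b (suc k) (y ∷ u ++ [ c ]) * weightGo a b (suc k + length (y ∷ u)) (c ∷ v))
      ≈⟨ ≈-sym (*-assoc _ _ _) ⟩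
    f * weightGo a b (suc k) (y ∷ u ++ [ c ]) * weightGo a b (suc k + length (y ∷ u)) (c ∷ v)
      ≡⟨ cong (λ i → f * weightGo a b (suc k) (y ∷ u ++ [ c ]) * weightGo a b i (c ∷ v))
              (sym (ℕₚ.+-suc k (length (y ∷ u)))) ⟩
    f * weightGo a b (suc k) (y ∷ u ++ [ c ]) * weightGo a b (k + length (x ∷ y ∷ u)) (c ∷ v) ∎
    where
    f = if x ≡ᵇ y then a y +ᴿ b k else 1#

  weight-exchange : ∀ (p q : List ℕ) c s t → length p ≡ length q →
                    w (q ++ c ∷ s) * w (p ++ c ∷ t) ≈ w (p ++ c ∷ s) * w (q ++ c ∷ t)
  weight-exchange p q c s t |p|≡|q| = begin
    w (q ++ c ∷ s) * w (p ++ c ∷ t)     ≈⟨ *-cong (weightGo-split 1 q c s) (weightGo-split 1 p c t) ⟩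
    (H q * tail q s) * (H p * tail p t) ≈⟨ interchange _ _ _ _ ⟩
    (H q * H p) * (tail q s * tail p t) ≈⟨ *-cong (*-comm _ _) (reflexive (cong₂ _*_ (tail≡ s) (sym (tail≡ t)))) ⟩
    (H p * H q) * (tail p s * tail q t) ≈⟨ interchange _ _ _ _ ⟩
    (H p * tail p s) * (H q * tail q t) ≈⟨ ≈-sym (*-cong (weightGo-split 1 p c s) (weightGo-split 1 q c t)) ⟩
    w (p ++ c ∷ s) * w (q ++ c ∷ t)     ∎
    where
    H : List ℕ → Carrier
    H u = weightGo a b 1 (u ++ [ c ])
    tail : List ℕ → List ℕ → Carrier
    tail u v = weightGo a b (1 + length u) (c ∷ v)
    tail≡ : ∀ v → tail q v ≡ tail p v
    tail≡ v = cong (λ i → weightGo a b (1 + i) (c ∷ v)) (sym |p|≡|q|)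

  tabWeight-swapped : ∀ {R} → Keyed length firstPart R → (S : Collision R) → tabWeight a b (swapped S) ≈ - tabWeight a b R
  tabWeight-swapped (_ , _ , firsts) (collision j _ _ c U V W p q s t refl |p| |q| _ _ _ _) = begin
    sgn (map firstPart R′) * prodR (map w R′)
      ≡⟨ cong (λ τ → sgn τ * prodR (map w R′)) first-parts′ ⟩
    sgn (FU ++ firstPart Y ∷ FV ++ firstPart X ∷ FW) * prodR (map w R′)
      ≈⟨ *-cong (sgn-transpose FU FV FW uniq) (prod-↭ w (two-front U V W X′ Y′)) ⟩
    (- sgn σ) * (w X′ * (w Y′ * rest))
      ≈⟨ *-congˡ (≈-trans (≈-sym (*-assoc _ _ _)) (*-congʳ (weight-exchange p q c s t (trans |p| (sym |q|))))) ⟩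
    (- sgn σ) * ((w X * w Y) * rest)
      ≈⟨ *-congˡ (≈-trans (*-assoc _ _ _) (≈-sym (prod-↭ w (two-front U V W X Y)))) ⟩
    (- sgn σ) * prodR (map w R)
      ≈⟨ ≈-sym (-‿distribˡ-* _ _) ⟩
    - (sgn σ * prodR (map w R))
      ≡⟨ cong (λ τ → - (sgn τ * prodR (map w R))) (sym (map-two firstPart U V W X Y)) ⟩
    - (sgn (map firstPart R) * prodR (map w R)) ∎
    where
    X = p ++ c ∷ s
    Y = q ++ c ∷ t
    X′ = q ++ c ∷ s
    Y′ = p ++ c ∷ t
    R = U ++ X ∷ V ++ Y ∷ W
    R′ = U ++ X′ ∷ V ++ Y′ ∷ W
    FU = map firstPart U
    FV = map firstPart V
    FW = map firstPart W
    σ = FU ++ firstPart X ∷ FV ++ firstPart Y ∷ FW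
    rest = prodR (map w (U ++ V ++ W))
    first-parts′ : map firstPart R′ ≡ FU ++ firstPart Y ∷ FV ++ firstPart X ∷ FW
    first-parts′ = trans (map-two firstPart U V W X′ Y′)
      (cong₂ (λ x y → FU ++ x ∷ FV ++ y ∷ FW) (firstPart-drop 0 q c s t z≤n) (firstPart-drop 0 p c t s z≤n))
    uniq : Unique σ
    uniq = subst Unique (map-two firstPart U V W X Y) (Unique-resp-↭ (↭-sym firsts) (Unique-range m))

  nonIntersecting? : Decidable (λ R → T (nonIntersecting m R))
  nonIntersecting? R = T? (nonIntersecting m R)

  intersecting : List (List (List ℕ))
  intersecting = filter (¬? ∘ nonIntersecting?) (tableaux n γ)

  ∈-intersecting⁻ : ∀ {R} → R ∈ intersecting → Keyed length firstPart R × Collision R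
  ∈-intersecting⁻ R∈ with ∈-filter⁻ (¬? ∘ nonIntersecting?) {xs = tableaux n γ} R∈
  ... | R∈′ , ¬ni = ∈-tableaux⁻ R∈′ , collision-of (proj₁ (proj₂ (∈-tableaux⁻ R∈′))) ¬ni

  exchange : SignReversingInvolution (tabWeight a b) intersecting
  exchange = record
    { ι           = ι
    ; closed      = closed
    ; involutive  = λ R∈ → let K , S = ∈-intersecting⁻ R∈ in
                    trans (cong ι (ι-collision S)) (trans (ι-collision (collision-swapped S)) (swapped-swapped S))
    ; no-fixpoint = λ R∈ → let (_ , _ , firsts) , S = ∈-intersecting⁻ R∈ in
                    λ eq → swapped-≢ (Unique-resp-↭ (↭-sym firsts) (Unique-range m)) S (trans (sym (ι-collision S)) eq)
    ; reverses    = λ R∈ → let K , S = ∈-intersecting⁻ R∈ in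
                    ≈-trans (reflexive (cong (tabWeight a b) (ι-collision S))) (tabWeight-swapped K S)
    }
    where
    closed : ∀ {R} → R ∈ intersecting → ι R ∈ intersecting
    closed R∈ with ∈-intersecting⁻ R∈
    ... | K , S = subst (_∈ intersecting) (sym (ι-collision S))
                    (∈-filter⁺ (¬? ∘ nonIntersecting?) (∈-tableaux⁺ (keyed-swapped K S))
                                (collision-bad (collision-swapped S)))

  Σni≈Σpi : Σni n γ a b ≈ Σpi n γ a b
  Σni≈Σpi = ≈-sym (begin
    Σpi n γ a b                                            ≈⟨ sum-filter nonIntersecting? (tabWeight a b) (tableaux n γ) ⟩
    Σni n γ a b +ᴿ sumR (map (tabWeight a b) intersecting) ≈⟨ +-congˡ cancels ⟩
    Σni n γ a b +ᴿ 0#                                      ≈⟨ +-identityʳ _ ⟩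
    Σni n γ a b                                            ∎)
    where
    cancels : sumR (map (tabWeight a b) intersecting) ≈ 0#
    cancels = involution-sum (tabWeight a b) intersecting
                             (Unique.filter⁺ (¬? ∘ nonIntersecting?) Unique-tableaux) exchange

lemma6 : {c ℓ : Level} (ℛ : CommutativeRing c ℓ) (n : ℕ) (γ : Vec Bool n)
         (a b : ℕ → CommutativeRing.Carrier ℛ) →
         CommutativeRing._≈_ ℛ (WithRing.Σni ℛ n γ a b) (WithRing.Σpi ℛ n γ a b)
         × CommutativeRing._≈_ ℛ (WithRing.Σpi ℛ n γ a b) (WithRing.det ℛ (suc n) (WithRing.M ℛ n γ a b))
lemma6 ℛ n γ a b = Cancellation.Σni≈Σpi ℛ n γ a b , Determinant.Σpi≈det ℛ n γ a b
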